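{- Let $2\le\ell\le n$. Then $\Theta_{n}^{(\ell,\ell)}=n+1$ if and only if $\frac{q}{q+1}(n+1)\leq \ell$.
   Context: Let $\mathcal{K}$ be a field with a discrete valuation $\nu$, valuation ring $\mathcal{O}$, maximal ideal $\mathfrak{m}$, and finite residue field $\mathcal{O}/\mathfrak{m}\cong\mathbb{F}_q$. Put $|\lambda|=q^{ -\nu(\lambda)}$, $\|\mathbf{v}\|=\max_{i}|v_i|$ on $\mathcal{K}^n$. Nonzero vectors $\mathbf{u}_1,\dots,\mathbf{u}_m$ form an orthogonal set if $\|\sum_i\lambda_i\mathbf{u}_i\|=\max_i\|\lambda_i\mathbf{u}_i\|$ for all $\lambda_i\in\mathcal{K}$. $S\subseteq\mathcal{K}^n\setminus\{\mathbf 0\}$ is $(k,\ell)$-orthogonal if every subset of $S$ of size $k$ contains an orthogonal subset of size $\ell$; $\Theta_n^{(k,\ell)}$ is the maximum size of such $S$. -}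

module Defs where

open import Level using (Level; _⊔_) renaming (suc to lsuc)
open import Algebra.Bundles using (CommutativeRing)
open import Data.Nat using (ℕ; zero; suc)
open import Data.Integer as ℤ using (ℤ)
open import Data.Fin using (Fin; zero; suc)
open import Data.List using (List; []; _∷_; length)
open import Data.List.Relation.Unary.All using (All)
open import Data.List.Relation.Unary.AllPairs using (AllPairs)
open import Data.List.Relation.Binary.Sublist.Propositional using (_⊆_)
open import Data.Product using (Σ; _×_; ∃; _,_)
open import Relation.Nullary using (¬_)
open import Relation.Binary.PropositionalEquality using (_≡_)

data ℤ∞ : Set where
  fin : ℤ → ℤ∞
  ∞   : ℤ∞

data _≤∞_ : ℤ∞ → ℤ∞ → Set where
  fin≤fin : ∀ {a b} → a ℤ.≤ b → fin a ≤∞ fin b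
  _≤∞∞    : ∀ x → x ≤∞ ∞

min∞ : ℤ∞ → ℤ∞ → ℤ∞
min∞ (fin a) (fin b) = fin (a ℤ.⊓ b)
min∞ (fin a) ∞       = fin a
min∞ ∞       y       = y

_+∞_ : ℤ∞ → ℤ∞ → ℤ∞
fin a +∞ fin b = fin (a ℤ.+ b)
fin a +∞ ∞     = ∞
∞     +∞ y     = ∞

minF : (m : ℕ) → (Fin m → ℤ∞) → ℤ∞
minF zero    f = ∞
minF (suc m) f = min∞ (f zero) (minF m (λ i → f (suc i)))

-- The absolute value is |λ| = q^{-ν(λ)};
-- since t ↦ q^{-t} is strictly decreasing, all comparisons of absolute
-- values / norms are expressed through ν (with ν(0) = ∞, |0| = 0).

record DVField (c ℓ : Level) : Set (lsuc (c ⊔ ℓ)) where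
  field
    commRing : CommutativeRing c ℓ
  open CommutativeRing commRing public
  field
    1≉0     : ¬ (1# ≈ 0#)
    inverse : ∀ x → ¬ (x ≈ 0#) → Σ Carrier (λ y → (x * y) ≈ 1#)
    ν        : Carrier → ℤ∞
    ν-cong   : ∀ {x y} → x ≈ y → ν x ≡ ν y
    ν-∞⇒0    : ∀ x → ν x ≡ ∞ → x ≈ 0#
    ν-0      : ν 0# ≡ ∞
    ν-*      : ∀ x y → ν (x * y) ≡ ν x +∞ ν y
    ν-+      : ∀ x y → min∞ (ν x) (ν y) ≤∞ ν (x + y)
    ν-surj   : ∀ (z : ℤ) → Σ Carrier (λ x → ν x ≡ fin z)
    -- residue field O/m ≅ 𝔽_q : a complete system of q representatives
    -- in O = {ν ≥ 0}, pairwise incongruent modulo m = {ν ≥ 1}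
    q             : ℕ
    residue       : Fin q → Carrier
    residue-int   : ∀ i → fin (ℤ.+ 0) ≤∞ ν (residue i)
    residue-inj   : ∀ i j → fin (ℤ.+ 1) ≤∞ ν (residue i - residue j) → i ≡ j
    residue-surj  : ∀ x → fin (ℤ.+ 0) ≤∞ ν x →
                    Σ (Fin q) (λ i → fin (ℤ.+ 1) ≤∞ ν (x - residue i))

module Orthogonality {c ℓ : Level} (K : DVField c ℓ) (n : ℕ) where
  open DVField K using (Carrier; _≈_; 0#; _+_; _*_; ν)

  Vecⁿ : Set c
  Vecⁿ = Fin n → Carrier

  _≈ᵛ_ : Vecⁿ → Vecⁿ → Set ℓ
  u ≈ᵛ v = ∀ i → u i ≈ v i

  0ᵛ : Vecⁿ
  0ᵛ i = 0#

  _+ᵛ_ : Vecⁿ → Vecⁿ → Vecⁿ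
  (u +ᵛ v) i = u i + v i

  _•_ : Carrier → Vecⁿ → Vecⁿ
  (a • v) i = a * v i

  -- ν‖v‖ = min_i ν(v_i), i.e. ‖v‖ = max_i |v_i| = q^{-ν‖v‖}
  ν‖_‖ : Vecⁿ → ℤ∞
  ν‖ v ‖ = minF n (λ i → ν (v i))

  lincomb : (us : List Vecⁿ) → (Fin (length us) → Carrier) → Vecⁿ
  lincomb []       λs = 0ᵛ
  lincomb (u ∷ us) λs = (λs zero • u) +ᵛ lincomb us (λ i → λs (suc i))

  scaled : (us : List Vecⁿ) → (Fin (length us) → Carrier) → Fin (length us) → Vecⁿ
  scaled (u ∷ us) λs zero    = λs zero • u
  scaled (u ∷ us) λs (suc i) = scaled us (λ j → λs (suc j)) i

  Orthogonal : List Vecⁿ → Set c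
  Orthogonal us = ∀ (λs : Fin (length us) → Carrier) →
    ν‖ lincomb us λs ‖ ≡ minF (length us) (λ i → ν‖ scaled us λs i ‖)

  -- a finite set S ⊆ K^n ∖ {0}, given as a duplicate-free list
  IsNonzeroSet : List Vecⁿ → Set (c ⊔ ℓ)
  IsNonzeroSet S = AllPairs (λ u v → ¬ (u ≈ᵛ v)) S × All (λ u → ¬ (u ≈ᵛ 0ᵛ)) S

  KLOrthogonal : ℕ → ℕ → List Vecⁿ → Set (c ⊔ ℓ)
  KLOrthogonal k l S = IsNonzeroSet S ×
    (∀ T → T ⊆ S → length T ≡ k →
       Σ (List Vecⁿ) (λ U → U ⊆ T × length U ≡ l × Orthogonal U))

  ΘIs : ℕ → ℕ → ℕ → Set (lsuc (c ⊔ ℓ))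
  ΘIs k l m =
    Level.Lift (lsuc (c ⊔ ℓ))
      ((Σ (List Vecⁿ) (λ S → KLOrthogonal k l S × length S ≡ m)) ×
       (∀ S → KLOrthogonal k l S → length S Data.Nat.≤ m))

-- Normalise every vector to norm 1. A normalised family is orthogonal exactly when its
-- reduction modulo 𝔪 is linearly independent over the residue field 𝒪/𝔪 ≅ 𝔽_q, so an
-- (ℓ,ℓ)-orthogonal set is a family in 𝒪ⁿ any ℓ of whose reductions are independent; dually,
-- every nontrivial relation between the reductions has more than ℓ unit coefficients.
-- The all-ones vector and the standard basis give n + 1 such vectors for every ℓ ≤ n.
-- Among n + 2 such vectors, two relations D₁, D₂ with D₂ vanishing where D₁ is a unit span
-- a pencil D₂, D₁ + ρ D₂ (ρ running through the residues) of q + 1 nontrivial relations;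
-- at every position at most q of them have a unit coefficient, so double counting gives
-- (q + 1)(ℓ + 1) ≤ (n + 2) q, which is impossible when q(n + 1) ≤ ℓ(q + 1). Conversely, if
-- q(n + 1) > ℓ(q + 1), the standard basis together with two vectors whose coordinate pairs
-- run evenly through the q + 1 points of the projective line over 𝔽_q is such a family of
-- size n + 2.

module Submission where

open import Defs
import Algebra.Properties.AbelianGroup as AbelianGroupProperties
import Algebra.Properties.CommutativeMonoid.Sum as CommutativeMonoidSum
import Algebra.Properties.CommutativeSemigroup as CommutativeSemigroupProperties
import Algebra.Properties.Ring as RingProperties
import Algebra.Properties.Semiring.Sum as SemiringSum
open import Data.Empty using (⊥-elim)
open import Data.Fin.Base using (Fin; zero; suc; toℕ; punchIn; cast)
import Data.Fin.Properties as Fin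
open import Data.Fin.Properties using (any?; punchInᵢ≢i)
open import Data.Integer.Base as ℤ using (+_; -[1+_])
import Data.Integer.Properties as ℤ
import Data.Integer.Tactic.RingSolver as ℤ-Solver
open import Data.List.Base using (List; []; _∷_; length; lookup; tabulate; take)
open import Data.List.Membership.Propositional.Properties using (∈-lookup)
open import Data.List.Properties using (length-tabulate; length-take)
open import Data.List.Relation.Binary.Pointwise using (Pointwise-≡⇒≡)
open import Data.List.Relation.Binary.Sublist.Heterogeneous.Properties using (toPointwise; take-Sublist)
open import Data.List.Relation.Binary.Sublist.Propositional using (_⊆_; []; _∷_; _∷ʳ_; ⊆-refl; ⊆-trans)
open import Data.List.Relation.Binary.Sublist.Propositional.Properties using (All-resp-⊆)
import Data.List.Relation.Unary.All as All
import Data.List.Relation.Unary.All.Properties as All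
open import Data.List.Relation.Unary.AllPairs using (AllPairs; []; _∷_)
import Data.List.Relation.Unary.AllPairs.Properties as AllPairs
open import Data.Nat.Base as ℕ using (ℕ; zero; suc; z≤n; s≤s; _%_)
open import Data.Nat.DivMod using (_mod_)
import Data.Nat.Properties as ℕ
import Data.Nat.Tactic.RingSolver as ℕ-Solver
open import Data.Product.Base using (Σ; ∃; _×_; _,_; proj₁; proj₂)
open import Data.Sum.Base using (_⊎_; inj₁; inj₂)
open import Data.Vec.Functional using (insertAt; removeAt)
open import Data.Vec.Functional.Properties using (insertAt-lookup; insertAt-punchIn)
open import Function.Base using (_∘_)
open import Function.Bundles using (_⇔_; mk⇔; Equivalence)
open import Level using (Level; _⊔_; lift)
open import Relation.Binary.Bundles using (Preorder)
open import Relation.Binary.PropositionalEquality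
  using (isEquivalence; _≡_; _≢_; refl; module ≡-Reasoning; sym; trans; cong; cong₂; subst)
import Relation.Binary.Reasoning.Preorder
import Relation.Binary.Reasoning.Setoid
open import Relation.Nullary using (¬_; Dec; yes; no; ¬?)
open import Relation.Nullary.Decidable using (decidable-stable)
open import Relation.Unary using (Pred; Decidable)

fin-injective : ∀ {a b} → fin a ≡ fin b → a ≡ b
fin-injective refl = refl

≤∞-refl : ∀ {x} → x ≤∞ x
≤∞-refl {fin a} = fin≤fin ℤ.≤-refl
≤∞-refl {∞}     = ∞ ≤∞∞

≤∞-reflexive : ∀ {x y} → x ≡ y → x ≤∞ y
≤∞-reflexive refl = ≤∞-refl

≤∞-trans : ∀ {x y z} → x ≤∞ y → y ≤∞ z → x ≤∞ z
≤∞-trans (fin≤fin p) (fin≤fin q) = fin≤fin (ℤ.≤-trans p q)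
≤∞-trans _           (_ ≤∞∞)     = _ ≤∞∞

∞≤∞⇒≡∞ : ∀ {x} → ∞ ≤∞ x → x ≡ ∞
∞≤∞⇒≡∞ (_ ≤∞∞) = refl

≤∞-antisym : ∀ {x y} → x ≤∞ y → y ≤∞ x → x ≡ y
≤∞-antisym (fin≤fin p) (fin≤fin q) = cong fin (ℤ.≤-antisym p q)
≤∞-antisym (_ ≤∞∞)     (_ ≤∞∞)     = refl

≤∞-preorder : Preorder _ _ _
≤∞-preorder = record
  { isPreorder = record { isEquivalence = isEquivalence ; reflexive = ≤∞-reflexive ; trans = ≤∞-trans } }

module ≤∞-Reasoning = Relation.Binary.Reasoning.Preorder ≤∞-preorder

_≤∞?_ : ∀ x y → Dec (x ≤∞ y)
x     ≤∞? ∞     = yes (x ≤∞∞)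
∞     ≤∞? fin b = no λ ()
fin a ≤∞? fin b with a ℤ.≤? b
... | yes a≤b = yes (fin≤fin a≤b)
... | no  a≰b = no λ { (fin≤fin a≤b) → a≰b a≤b }

≰∞⇒suc≤∞ : ∀ {x z} → ¬ x ≤∞ fin z → fin (ℤ.suc z) ≤∞ x
≰∞⇒suc≤∞ {fin a} x≰z = fin≤fin (ℤ.i<j⇒suc[i]≤j (ℤ.≰⇒> (λ a≤z → x≰z (fin≤fin a≤z))))
≰∞⇒suc≤∞ {∞}     _   = _ ≤∞∞

min∞-≤ˡ : ∀ x y → min∞ x y ≤∞ x
min∞-≤ˡ (fin a) (fin b) = fin≤fin (ℤ.i⊓j≤i a b)
min∞-≤ˡ (fin a) ∞       = ≤∞-refl
min∞-≤ˡ ∞       y       = _ ≤∞∞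

min∞-≤ʳ : ∀ x y → min∞ x y ≤∞ y
min∞-≤ʳ (fin a) (fin b) = fin≤fin (ℤ.i⊓j≤j a b)
min∞-≤ʳ (fin a) ∞       = _ ≤∞∞
min∞-≤ʳ ∞       y       = ≤∞-refl

min∞-glb : ∀ {z x y} → z ≤∞ x → z ≤∞ y → z ≤∞ min∞ x y
min∞-glb (fin≤fin p) (fin≤fin q) = fin≤fin (ℤ.⊓-glb p q)
min∞-glb (fin≤fin p) (_ ≤∞∞)     = fin≤fin p
min∞-glb (_ ≤∞∞)     q           = q

min∞-sel : ∀ x y → min∞ x y ≡ x ⊎ min∞ x y ≡ y
min∞-sel (fin a) (fin b) with ℤ.⊓-sel a b
... | inj₁ a⊓b≡a = inj₁ (cong fin a⊓b≡a)
... | inj₂ a⊓b≡b = inj₂ (cong fin a⊓b≡b)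
min∞-sel (fin a) ∞       = inj₁ refl
min∞-sel ∞       y       = inj₂ refl

+∞-mono-≤ : ∀ {x y u v} → x ≤∞ y → u ≤∞ v → (x +∞ u) ≤∞ (y +∞ v)
+∞-mono-≤ (fin≤fin p) (fin≤fin q) = fin≤fin (ℤ.+-mono-≤ p q)
+∞-mono-≤ (fin≤fin p) (_ ≤∞∞)     = _ ≤∞∞
+∞-mono-≤ {fin a} {u = fin b} (_ ≤∞∞) _ = _ ≤∞∞
+∞-mono-≤ {fin a} {u = ∞}     (_ ≤∞∞) _ = _ ≤∞∞
+∞-mono-≤ {∞}                 (_ ≤∞∞) _ = _ ≤∞∞

+∞-identityˡ : ∀ x → fin (+ 0) +∞ x ≡ x
+∞-identityˡ (fin a) = cong fin (ℤ.+-identityˡ a)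
+∞-identityˡ ∞       = refl

+∞-identityʳ : ∀ x → x +∞ fin (+ 0) ≡ x
+∞-identityʳ (fin a) = cong fin (ℤ.+-identityʳ a)
+∞-identityʳ ∞       = refl

+∞-zeroʳ : ∀ x → x +∞ ∞ ≡ ∞
+∞-zeroʳ (fin a) = refl
+∞-zeroʳ ∞       = refl

+∞-distribˡ-min∞ : ∀ x y z → x +∞ min∞ y z ≡ min∞ (x +∞ y) (x +∞ z)
+∞-distribˡ-min∞ (fin a) (fin b) (fin c) = cong fin (ℤ.mono-≤-distrib-⊓ (ℤ.+-monoʳ-≤ a) b c)
+∞-distribˡ-min∞ (fin a) (fin b) ∞       = refl
+∞-distribˡ-min∞ (fin a) ∞       z       = refl
+∞-distribˡ-min∞ ∞       y       z       = refl

minF-≤ : ∀ m (f : Fin m → ℤ∞) i → minF m f ≤∞ f i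
minF-≤ (suc m) f zero    = min∞-≤ˡ _ _
minF-≤ (suc m) f (suc i) = ≤∞-trans (min∞-≤ʳ _ _) (minF-≤ m (λ j → f (suc j)) i)

minF-glb : ∀ m (f : Fin m → ℤ∞) {z} → (∀ i → z ≤∞ f i) → z ≤∞ minF m f
minF-glb zero    f z≤f = _ ≤∞∞
minF-glb (suc m) f z≤f = min∞-glb (z≤f zero) (minF-glb m (λ j → f (suc j)) (λ j → z≤f (suc j)))

minF-cong : ∀ m {f g : Fin m → ℤ∞} → (∀ i → f i ≡ g i) → minF m f ≡ minF m g
minF-cong zero    f≗g = refl
minF-cong (suc m) f≗g = cong₂ min∞ (f≗g zero) (minF-cong m (λ i → f≗g (suc i)))

minF-attained : ∀ m (f : Fin m → ℤ∞) → minF m f ≡ ∞ ⊎ ∃ λ i → minF m f ≡ f i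
minF-attained zero    f = inj₁ refl
minF-attained (suc m) f with min∞-sel (f zero) (minF m (λ j → f (suc j)))
... | inj₁ eq = inj₂ (zero , eq)
... | inj₂ eq with minF-attained m (λ j → f (suc j))
...   | inj₁ eq′       = inj₁ (trans eq eq′)
...   | inj₂ (i , eq′) = inj₂ (suc i , trans eq eq′)

minF-+∞ : ∀ m x (f : Fin m → ℤ∞) → minF m (λ i → x +∞ f i) ≡ x +∞ minF m f
minF-+∞ zero    x f = sym (+∞-zeroʳ x)
minF-+∞ (suc m) x f =
  trans (cong (min∞ (x +∞ f zero)) (minF-+∞ m x (λ i → f (suc i))))
        (sym (+∞-distribˡ-min∞ x _ _))

minF-∞ : ∀ m → minF m (λ _ → ∞) ≡ ∞
minF-∞ zero    = refl
minF-∞ (suc m) = minF-∞ m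

module _ where
  open import Data.Nat.Base using (_+_; _*_; _≤_; _<_; _%_)
  open import Data.Nat.DivMod using (m<n⇒m%n≡m; [m+n]%n≡m%n)
  open CommutativeMonoidSum ℕ.+-0-commutativeMonoid using (sum; sum-cong-≗; ∑-distrib-+; ∑-comm)

  ∑-mono-≤ : ∀ {m} {f g : Fin m → ℕ} → (∀ i → f i ≤ g i) → sum f ≤ sum g
  ∑-mono-≤ {zero}  f≤g = z≤n
  ∑-mono-≤ {suc m} f≤g = ℕ.+-mono-≤ (f≤g zero) (∑-mono-≤ (f≤g ∘ suc))

  ∑-const : ∀ m a → sum {m} (λ _ → a) ≡ m * a
  ∑-const zero    a = refl
  ∑-const (suc m) a = cong (_+_ a) (∑-const m a)

  indicator : ∀ {p} {P : Set p} → Dec P → ℕ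
  indicator (yes _) = 1
  indicator (no _)  = 0

  indicator≤1 : ∀ {p} {P : Set p} (P? : Dec P) → indicator P? ≤ 1
  indicator≤1 (yes _) = ℕ.≤-refl
  indicator≤1 (no _)  = z≤n

  indicator-mono : ∀ {p q} {P : Set p} {Q : Set q} → (P → Q) → (P? : Dec P) (Q? : Dec Q) →
                   indicator P? ≤ indicator Q?
  indicator-mono P⇒Q (yes p) (yes _) = ℕ.≤-refl
  indicator-mono P⇒Q (yes p) (no ¬q) = ⊥-elim (¬q (P⇒Q p))
  indicator-mono P⇒Q (no _)  _       = z≤n

  indicator-¬ : ∀ {p} {P : Set p} → ¬ P → (P? : Dec P) → indicator P? ≡ 0
  indicator-¬ ¬p (yes p) = ⊥-elim (¬p p)
  indicator-¬ ¬p (no _)  = refl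

  count : ∀ {p m} {P : Pred (Fin m) p} → Decidable P → ℕ
  count P? = sum (λ i → indicator (P? i))

  count≤ : ∀ {p m} {P : Pred (Fin m) p} (P? : Decidable P) → count P? ≤ m
  count≤ {m = m} P? =
    ℕ.≤-trans (∑-mono-≤ (indicator≤1 ∘ P?)) (ℕ.≤-reflexive (trans (∑-const m 1) (ℕ.*-identityʳ m)))

  count-mono : ∀ {p q m} {P : Pred (Fin m) p} {Q : Pred (Fin m) q} (P? : Decidable P) (Q? : Decidable Q) →
               (∀ i → P i → Q i) → count P? ≤ count Q?
  count-mono P? Q? P⇒Q = ∑-mono-≤ λ i → indicator-mono (P⇒Q i) (P? i) (Q? i)

  count-∪ : ∀ {p q r m} {P : Pred (Fin m) p} {Q : Pred (Fin m) q} {R : Pred (Fin m) r}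
            (P? : Decidable P) (Q? : Decidable Q) (R? : Decidable R) →
            (∀ i → P i → Q i ⊎ R i) → count P? ≤ count Q? + count R?
  count-∪ P? Q? R? P⇒Q∪R = ℕ.≤-trans (∑-mono-≤ λ i → split (P⇒Q∪R i) (P? i) (Q? i) (R? i))
                                     (ℕ.≤-reflexive (∑-distrib-+ (indicator ∘ Q?) (indicator ∘ R?)))
    where
    split : ∀ {a b c} {A : Set a} {B : Set b} {C : Set c} → (A → B ⊎ C) →
            (A? : Dec A) (B? : Dec B) (C? : Dec C) → indicator A? ≤ indicator B? + indicator C?
    split A⇒B∪C (no _)  B?      C?      = z≤n
    split A⇒B∪C (yes _) (yes _) C?      = s≤s z≤n
    split A⇒B∪C (yes a) (no ¬b) (yes _) = ℕ.≤-refl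
    split A⇒B∪C (yes a) (no ¬b) (no ¬c) with A⇒B∪C a
    ... | inj₁ b = ⊥-elim (¬b b)
    ... | inj₂ c = ⊥-elim (¬c c)

  count-∁ : ∀ {p m} {P : Pred (Fin m) p} (P? : Decidable P) → count P? + count (¬? ∘ P?) ≡ m
  count-∁ {m = m} P? = begin
    count P? + count (¬? ∘ P?)                           ≡⟨ ∑-distrib-+ (indicator ∘ P?) (indicator ∘ ¬? ∘ P?) ⟨
    sum (λ i → indicator (P? i) + indicator (¬? (P? i)))  ≡⟨ sum-cong-≗ (λ i → one (P? i)) ⟩
    sum {m} (λ _ → 1)                                    ≡⟨ trans (∑-const m 1) (ℕ.*-identityʳ m) ⟩
    m                                                    ∎
    where
    open ≡-Reasoning
    one : ∀ {a} {A : Set a} (A? : Dec A) → indicator A? + indicator (¬? A?) ≡ 1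
    one (yes _) = refl
    one (no _)  = refl

  count-none : ∀ {p m} {P : Pred (Fin m) p} (P? : Decidable P) → (∀ i → ¬ P i) → count P? ≡ 0
  count-none {m = m} P? ¬P =
    trans (sum-cong-≗ (λ i → indicator-¬ (¬P i) (P? i))) (trans (∑-const m 0) (ℕ.*-zeroʳ m))

  count-all : ∀ {p m} {P : Pred (Fin m) p} (P? : Decidable P) → (∀ i → P i) → count P? ≡ m
  count-all {m = m} P? allP = begin
    count P?                    ≡⟨ ℕ.+-identityʳ (count P?) ⟨
    count P? + 0                ≡⟨ cong (_+_ (count P?)) (count-none (¬? ∘ P?) (λ i ¬p → ¬p (allP i))) ⟨
    count P? + count (¬? ∘ P?)  ≡⟨ count-∁ P? ⟩
    m                           ∎
    where open ≡-Reasoning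

  count-≤1 : ∀ {p m} {P : Pred (Fin m) p} (P? : Decidable P) → (∀ {i j} → P i → P j → i ≡ j) → count P? ≤ 1
  count-≤1 {m = zero}  P? unique = z≤n
  count-≤1 {m = suc m} P? unique with P? zero
  ... | yes p₀ = ℕ.≤-reflexive (cong ℕ.suc (count-none (P? ∘ suc) λ i p → 0≢suc (unique p₀ p)))
    where
    0≢suc : ∀ {i : Fin m} → zero ≢ suc i
    0≢suc ()
  ... | no _   = count-≤1 (P? ∘ suc) λ p q → Fin.suc-injective (unique p q)

  count-< : ∀ {p m} {P : Pred (Fin m) p} (P? : Decidable P) {i} → ¬ P i → count P? < m
  count-< {m = suc m} P? {zero} ¬p with P? zero
  ... | yes p = ⊥-elim (¬p p)
  ... | no _  = s≤s (count≤ (P? ∘ suc))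
  count-< {m = suc m} P? {suc i} ¬p =
    s≤s (ℕ.≤-trans (ℕ.+-monoˡ-≤ _ (indicator≤1 (P? zero))) (count-< (P? ∘ suc) ¬p))

  count-+ : ∀ {p} {P : Pred ℕ p} (P? : Decidable P) a b →
            count {m = a + b} (P? ∘ toℕ) ≡ count {m = a} (P? ∘ toℕ) + count {m = b} (λ i → P? (a + toℕ i))
  count-+ P? zero    b = refl
  count-+ P? (suc a) b = trans (cong (_+_ (indicator (P? 0))) (count-+ (P? ∘ suc) a b))
                                 (sym (ℕ.+-assoc (indicator (P? 0)) _ _))

  double-count : ∀ {p a b r} {P : Fin (suc a) → Fin b → Set p} (P? : ∀ t k → Dec (P t k)) →
                 (∀ t → r ≤ count (P? t)) → (∀ k → ∃ λ t → ¬ P t k) → suc a * r ≤ b * a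
  double-count {a = a} {b} {r} P? r≤rows column-misses = begin
    suc a * r                         ≡⟨ ∑-const (suc a) r ⟨
    sum {suc a} (λ _ → r)             ≤⟨ ∑-mono-≤ r≤rows ⟩
    sum (λ t → count (P? t))          ≡⟨ ∑-comm (λ t k → indicator (P? t k)) ⟩
    sum (λ k → count (λ t → P? t k))  ≤⟨ ∑-mono-≤ column-count ⟩
    sum {b} (λ _ → a)                 ≡⟨ ∑-const b a ⟩
    b * a                             ∎
    where
    open ℕ.≤-Reasoning
    column-count : ∀ k → count (λ t → P? t k) ≤ a
    column-count k = ℕ.≤-pred (count-< (λ t → P? t k) (proj₂ (column-misses k)))

  count-prefix : ∀ {p} {P : Pred ℕ p} (P? : Decidable P) {a b} → a ≤ b →
                 count {m = a} (P? ∘ toℕ) ≤ count {m = b} (P? ∘ toℕ)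
  count-prefix P? {a} a≤b with ℕ.m≤n⇒∃[o]m+o≡n a≤b
  ... | k , refl = ℕ.≤-trans (ℕ.m≤m+n _ _) (ℕ.≤-reflexive (sym (count-+ P? a k)))

  count-mod : ∀ d .{{_ : ℕ.NonZero d}} t → t < d → ∀ C →
              count {m = C * d + t} (λ i → toℕ i % d ℕ.≟ t) ≤ C
  count-mod d t t<d zero = ℕ.≤-reflexive (count-none (λ i → toℕ i % d ℕ.≟ t) λ i i%d≡t →
    ℕ.<-irrefl (trans (sym (m<n⇒m%n≡m (ℕ.<-trans (Fin.toℕ<n i) t<d))) i%d≡t) (Fin.toℕ<n i))
  count-mod d t t<d (suc C) = subst (λ N → count {m = N} (P? ∘ toℕ) ≤ suc C) (sym (ℕ.+-assoc d (C * d) t)) (begin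
    count {m = d + (C * d + t)} (P? ∘ toℕ)                                   ≡⟨ count-+ P? d (C * d + t) ⟩
    count {m = d} (P? ∘ toℕ) + count {m = C * d + t} (λ i → P? (d + toℕ i))  ≤⟨ ℕ.+-mono-≤ first-block rest ⟩
    1 + C                                                                    ∎)
    where
    open ℕ.≤-Reasoning
    P? : ∀ v → Dec (v % d ≡ t)
    P? v = v % d ℕ.≟ t
    first-block : count {m = d} (P? ∘ toℕ) ≤ 1
    first-block = count-≤1 (P? ∘ toℕ) λ {i} {j} i≡t j≡t → Fin.toℕ-injective (begin-equality
      toℕ i      ≡⟨ m<n⇒m%n≡m (Fin.toℕ<n i) ⟨
      toℕ i % d  ≡⟨ trans i≡t (sym j≡t) ⟩
      toℕ j % d  ≡⟨ m<n⇒m%n≡m (Fin.toℕ<n j) ⟩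
      toℕ j      ∎)
    rest : count {m = C * d + t} (λ i → P? (d + toℕ i)) ≤ C
    rest = ℕ.≤-trans (count-mono {m = C * d + t} (λ i → P? (d + toℕ i)) (P? ∘ toℕ) λ i → trans (i%d≡[d+i]%d i))
                     (count-mod d t t<d C)
      where
      i%d≡[d+i]%d : ∀ i → toℕ i % d ≡ (d + toℕ i) % d
      i%d≡[d+i]%d i = trans (sym ([m+n]%n≡m%n (toℕ i) d)) (cong (_% d) (ℕ.+-comm (toℕ i) d))

module _ {a} {A : Set a} where
  open import Data.Nat.Base using (_≤_)

  embed : ∀ {xs ys : List A} → xs ⊆ ys → Fin (length xs) → Fin (length ys)
  embed (y ∷ʳ p)   j       = suc (embed p j)
  embed (refl ∷ p) zero    = zero
  embed (refl ∷ p) (suc j) = suc (embed p j)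

  lookup-embed : ∀ {xs ys : List A} (p : xs ⊆ ys) j → lookup xs j ≡ lookup ys (embed p j)
  lookup-embed (y ∷ʳ p)   j       = lookup-embed p j
  lookup-embed (refl ∷ p) zero    = refl
  lookup-embed (refl ∷ p) (suc j) = lookup-embed p j

  record Covering {p} (ys : List A) (P : Pred (Fin (length ys)) p) (k : ℕ) : Set (a ⊔ p) where
    field
      {sub}   : List A
      sub⊆ys  : sub ⊆ ys
      length≡ : length sub ≡ k
      covers  : ∀ i → P i → ∃ λ j → embed sub⊆ys j ≡ i

  module _ {p y ys} {P : Pred (Fin (length (y ∷ ys))) p} {k} (c : Covering ys (P ∘ suc) k) where
    open Covering c

    Covering-keep : Covering (y ∷ ys) P (suc k)
    Covering-keep = record { sub⊆ys = refl ∷ sub⊆ys ; length≡ = cong ℕ.suc length≡ ; covers = covers′ }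
      where
      covers′ : ∀ i → P i → ∃ λ j → embed (refl ∷ sub⊆ys) j ≡ i
      covers′ zero    _  = zero , refl
      covers′ (suc i) Pi = let j , eq = covers i Pi in suc j , cong suc eq

    Covering-skip : ¬ P zero → Covering (y ∷ ys) P k
    Covering-skip ¬P₀ = record { sub⊆ys = y ∷ʳ sub⊆ys ; length≡ = length≡ ; covers = covers′ }
      where
      covers′ : ∀ i → P i → ∃ λ j → embed (y ∷ʳ sub⊆ys) j ≡ i
      covers′ zero    P₀ = ⊥-elim (¬P₀ P₀)
      covers′ (suc i) Pi = let j , eq = covers i Pi in j , cong suc eq

  cover : ∀ {p} (ys : List A) {P : Pred (Fin (length ys)) p} (P? : Decidable P) k →
          count P? ≤ k → k ≤ length ys → Covering ys P k
  cover []       P? zero z≤n z≤n = record { sub⊆ys = [] ; length≡ = refl ; covers = λ () }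
  cover (y ∷ ys) P? k c≤k k≤1+ys with P? zero
  cover (y ∷ ys) P? zero    ()        _          | yes _
  cover (y ∷ ys) P? (suc k) (s≤s c≤k) (s≤s k≤ys) | yes _ = Covering-keep (cover ys (P? ∘ suc) k c≤k k≤ys)
  ... | no ¬P₀ with k ℕ.≤? length ys
  ...   | yes k≤ys = Covering-skip (cover ys (P? ∘ suc) k c≤k k≤ys) ¬P₀
  ...   | no  k≰ys = subst (Covering (y ∷ ys) _) (ℕ.≤-antisym (ℕ.≰⇒> k≰ys) k≤1+ys)
                       (Covering-keep (cover ys (P? ∘ suc) (length ys) (count≤ (P? ∘ suc)) ℕ.≤-refl))

  AllPairs-resp-⊆ : ∀ {r} {R : A → A → Set r} {xs ys : List A} → xs ⊆ ys → AllPairs R ys → AllPairs R xs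
  AllPairs-resp-⊆ []         []           = []
  AllPairs-resp-⊆ (y ∷ʳ p)   (_ ∷ Rys)    = AllPairs-resp-⊆ p Rys
  AllPairs-resp-⊆ (refl ∷ p) (Ry ∷ Rys)   = All-resp-⊆ p Ry ∷ AllPairs-resp-⊆ p Rys

lookup-tabulate-cast : ∀ {a m} {A : Set a} (f : Fin m → A) j →
                       lookup (tabulate f) j ≡ f (cast (length-tabulate f) j)
lookup-tabulate-cast {m = suc m} f zero    = refl
lookup-tabulate-cast {m = suc m} f (suc j) = lookup-tabulate-cast (f ∘ suc) j

insertAt-pointwise : ∀ {a p m} {A : Set a} {P : A → Set p} (xs : Fin m → A) i {x} →
                     P x → (∀ j → P (xs j)) → ∀ k → P (insertAt xs i x k)
insertAt-pointwise                     xs zero    Px Pxs zero    = Px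
insertAt-pointwise                     xs zero    Px Pxs (suc k) = Pxs k
insertAt-pointwise {m = suc m}         xs (suc i) Px Pxs zero    = Pxs zero
insertAt-pointwise {m = suc m} {P = P} xs (suc i) Px Pxs (suc k) =
  insertAt-pointwise {P = P} (xs ∘ suc) i Px (Pxs ∘ suc) k

module _ where
  open import Data.Nat.Base using (_+_; _*_; _≤_)
  open ℕ.≤-Reasoning

  pencil-count-absurd : ∀ q n l → q * suc n ≤ l * (q + 1) → ¬ suc q * suc l ≤ suc (suc n) * q
  pencil-count-absurd q n l q[n+1]≤l[q+1] pencil-count = ℕ.1+n≰n (begin
    suc (l * (q + 1) + q)   ≡⟨ 1+l[q+1]+q≡[1+q][1+l] q l ⟩
    suc q * suc l           ≤⟨ pencil-count ⟩
    suc (suc n) * q         ≡⟨ [2+n]q≡q[1+n]+q q n ⟩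
    q * suc n + q           ≤⟨ ℕ.+-monoˡ-≤ q q[n+1]≤l[q+1] ⟩
    l * (q + 1) + q         ∎)
    where
    1+l[q+1]+q≡[1+q][1+l] : ∀ q l → suc (l * (q + 1) + q) ≡ suc q * suc l
    1+l[q+1]+q≡[1+q][1+l] = ℕ-Solver.solve-∀
    [2+n]q≡q[1+n]+q : ∀ q n → suc (suc n) * q ≡ q * suc n + q
    [2+n]q≡q[1+n]+q = ℕ-Solver.solve-∀

  room-for-classes : ∀ q n T l → n ≡ T + l → ¬ q * suc n ≤ l * (q + 1) → suc (suc n) ≤ suc T * suc q
  room-for-classes q _ T l refl too-few = begin
    suc (suc (T + l))       ≡⟨ 2+T+l≡[1+T]+[1+l] T l ⟩
    suc T + suc l           ≤⟨ ℕ.+-monoʳ-≤ (suc T) 1+l≤q[1+T] ⟩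
    suc T + q * suc T       ≡⟨ [1+T]+q[1+T]≡[1+T][1+q] q T ⟩
    suc T * suc q           ∎
    where
    2+T+l≡[1+T]+[1+l] : ∀ T l → suc (suc (T + l)) ≡ suc T + suc l
    2+T+l≡[1+T]+[1+l] = ℕ-Solver.solve-∀
    [1+T]+q[1+T]≡[1+T][1+q] : ∀ q T → suc T + q * suc T ≡ suc T * suc q
    [1+T]+q[1+T]≡[1+T][1+q] = ℕ-Solver.solve-∀
    ql+[1+l]≡1+l[q+1] : ∀ q l → q * l + suc l ≡ suc (l * (q + 1))
    ql+[1+l]≡1+l[q+1] = ℕ-Solver.solve-∀
    q[1+T+l]≡ql+q[1+T] : ∀ q T l → q * suc (T + l) ≡ q * l + q * suc T
    q[1+T+l]≡ql+q[1+T] = ℕ-Solver.solve-∀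
    1+l≤q[1+T] : suc l ≤ q * suc T
    1+l≤q[1+T] = ℕ.+-cancelˡ-≤ (q * l) _ _ (begin
      q * l + suc l          ≡⟨ ql+[1+l]≡1+l[q+1] q l ⟩
      suc (l * (q + 1))      ≤⟨ ℕ.≰⇒> too-few ⟩
      q * suc (T + l)        ≡⟨ q[1+T+l]≡ql+q[1+T] q T l ⟩
      q * l + q * suc T      ∎)

-- The valuation ring 𝒪 and its maximal ideal 𝔪

module _ {c ℓ′} (K : DVField c ℓ′) where
  open DVField K renaming (refl to ≈-refl; sym to ≈-sym; trans to ≈-trans; zero to *-zero)
  open RingProperties ring
    using (-1*x≈-x; -‿involutive; -0#≈0#; -‿distribˡ-*; x[y-z]≈xy-xz; [y-z]x≈yx-zx; ⁻¹-anti-homo‿-; -‿+-comm)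
  open SemiringSum semiring
    using (sum; sum-cong-≋; sum-replicate-zero; *-distribˡ-sum; *-distribʳ-sum; ∑-distrib-+; sum-remove)
  open CommutativeSemigroupProperties +-commutativeSemigroup using (x∙yz≈y∙xz; interchange)
  module ≈-Reasoning = Relation.Binary.Reasoning.Setoid setoid

  infix 4 _≤ν_
  _≤ν_ : ℤ∞ → Carrier → Set
  k ≤ν x = k ≤∞ ν x

  𝒪 𝔪 : Carrier → Set
  𝒪 x = fin (+ 0) ≤ν x
  𝔪 x = fin (+ 1) ≤ν x

  𝔪? : ∀ x → Dec (𝔪 x)
  𝔪? x = fin (+ 1) ≤∞? ν x

  ≤ν-resp-≈ : ∀ {k x y} → x ≈ y → k ≤ν x → k ≤ν y
  ≤ν-resp-≈ x≈y = subst (_ ≤∞_) (ν-cong x≈y)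

  ≤ν-0# : ∀ k → k ≤ν 0#
  ≤ν-0# k = subst (k ≤∞_) (sym ν-0) (k ≤∞∞)

  ≈0⇒≤ν : ∀ {k x} → x ≈ 0# → k ≤ν x
  ≈0⇒≤ν x≈0 = ≤ν-resp-≈ (≈-sym x≈0) (≤ν-0# _)

  ≤ν-+ : ∀ {k x y} → k ≤ν x → k ≤ν y → k ≤ν x + y
  ≤ν-+ k≤x k≤y = ≤∞-trans (min∞-glb k≤x k≤y) (ν-+ _ _)

  ≤ν-* : ∀ {j k x y} → j ≤ν x → k ≤ν y → j +∞ k ≤ν x * y
  ≤ν-* j≤x k≤y = subst (_ ≤∞_) (sym (ν-* _ _)) (+∞-mono-≤ j≤x k≤y)

  𝒪-* : ∀ {x y} → 𝒪 x → 𝒪 y → 𝒪 (x * y)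
  𝒪-* = ≤ν-*

  𝔪-*ˡ : ∀ {x y} → 𝔪 x → 𝒪 y → 𝔪 (x * y)
  𝔪-*ˡ = ≤ν-*

  𝔪-*ʳ : ∀ {x y} → 𝒪 x → 𝔪 y → 𝔪 (x * y)
  𝔪-*ʳ = ≤ν-*

  ≤ν-sum : ∀ {k m} (f : Fin m → Carrier) → (∀ i → k ≤ν f i) → k ≤ν sum f
  ≤ν-sum {m = zero}  f k≤f = ≤ν-0# _
  ≤ν-sum {m = suc m} f k≤f = ≤ν-+ (k≤f zero) (≤ν-sum (f ∘ suc) (k≤f ∘ suc))

  ν-1# : ν 1# ≡ fin (+ 0)
  ν-1# with ν 1# in eq
  ... | ∞     = ⊥-elim (1≉0 (ν-∞⇒0 1# eq))
  ... | fin a = cong fin (ℤGroup.identityˡ-unique a a (fin-injective a+a≡a))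
    where
    module ℤGroup = AbelianGroupProperties ℤ.+-0-abelianGroup
    a+a≡a : fin (a ℤ.+ a) ≡ fin a
    a+a≡a = trans (sym (cong₂ _+∞_ eq eq)) (trans (sym (ν-* 1# 1#)) (trans (ν-cong (*-identityˡ 1#)) eq))

  ν-‿1# : ν (- 1#) ≡ fin (+ 0)
  ν-‿1# with ν (- 1#) in eq
  ... | ∞     = ⊥-elim (1≉0 (≈-trans (≈-sym (-‿involutive 1#)) (≈-trans (-‿cong (ν-∞⇒0 _ eq)) -0#≈0#)))
  ... | fin a = cong fin (i+i≡0⇒i≡0 a (fin-injective a+a≡0))
    where
    i+i≡0⇒i≡0 : ∀ i → i ℤ.+ i ≡ + 0 → i ≡ + 0
    i+i≡0⇒i≡0 (+ zero)  _  = refl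
    i+i≡0⇒i≡0 (+ suc n) ()
    i+i≡0⇒i≡0 -[1+ n ]  ()
    a+a≡0 : fin (a ℤ.+ a) ≡ fin (+ 0)
    a+a≡0 = trans (sym (cong₂ _+∞_ eq eq))
            (trans (sym (ν-* (- 1#) (- 1#))) (trans (ν-cong (≈-trans (-1*x≈-x (- 1#)) (-‿involutive 1#))) ν-1#))

  ν-neg : ∀ x → ν (- x) ≡ ν x
  ν-neg x = begin
    ν (- x)             ≡⟨ ν-cong (-1*x≈-x x) ⟨
    ν (- 1# * x)        ≡⟨ ν-* (- 1#) x ⟩
    ν (- 1#) +∞ ν x     ≡⟨ cong (_+∞ ν x) ν-‿1# ⟩
    fin (+ 0) +∞ ν x    ≡⟨ +∞-identityˡ (ν x) ⟩
    ν x                 ∎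
    where open ≡-Reasoning

  ≤ν-neg : ∀ {k x} → k ≤ν x → k ≤ν - x
  ≤ν-neg {x = x} = subst (_ ≤∞_) (sym (ν-neg x))

  ≤ν-sub : ∀ {k x y} → k ≤ν x → k ≤ν y → k ≤ν x - y
  ≤ν-sub k≤x k≤y = ≤ν-+ k≤x (≤ν-neg k≤y)

  𝒪-1# : 𝒪 1#
  𝒪-1# = ≤∞-reflexive (sym ν-1#)

  ν≡0⇒¬𝔪 : ∀ {x} → ν x ≡ fin (+ 0) → ¬ 𝔪 x
  ν≡0⇒¬𝔪 νx≡0 𝔪x with subst (fin (+ 1) ≤∞_) νx≡0 𝔪x
  ... | fin≤fin (ℤ.+≤+ ())

  ¬𝔪-1# : ¬ 𝔪 1#
  ¬𝔪-1# = ν≡0⇒¬𝔪 ν-1#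

  𝔪-cancelʳ : ∀ {x y} → 𝔪 (x + y) → 𝔪 y → 𝔪 x
  𝔪-cancelʳ {x} {y} 𝔪x+y 𝔪y = ≤ν-resp-≈ x+y-y≈x (≤ν-sub 𝔪x+y 𝔪y)
    where
    open ≈-Reasoning
    x+y-y≈x : (x + y) - y ≈ x
    x+y-y≈x = begin
      (x + y) - y   ≈⟨ +-assoc x y (- y) ⟩
      x + (y - y)   ≈⟨ +-congˡ (-‿inverseʳ y) ⟩
      x + 0#        ≈⟨ +-identityʳ x ⟩
      x             ∎

  𝔪-cancelˡ : ∀ {x y} → 𝔪 (x + y) → 𝔪 x → 𝔪 y
  𝔪-cancelˡ {x} {y} 𝔪x+y = 𝔪-cancelʳ (≤ν-resp-≈ (+-comm x y) 𝔪x+y)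

  unit⇒ν≡0 : ∀ {x} → 𝒪 x → ¬ 𝔪 x → ν x ≡ fin (+ 0)
  unit⇒ν≡0 {x} 𝒪x ¬𝔪x with ν x
  ... | ∞             = ⊥-elim (¬𝔪x (_ ≤∞∞))
  ... | fin (+ zero)  = refl
  ... | fin (+ suc n) = ⊥-elim (¬𝔪x (fin≤fin (ℤ.+≤+ (s≤s z≤n))))
  ... | fin -[1+ n ] with 𝒪x
  ...   | fin≤fin ()

  unit-inverse : ∀ {x} → 𝒪 x → ¬ 𝔪 x → Σ Carrier λ y → x * y ≈ 1# × 𝒪 y
  unit-inverse {x} 𝒪x ¬𝔪x with inverse x (¬𝔪x ∘ ≈0⇒≤ν)
  ... | y , xy≈1 = y , xy≈1 , ≤∞-reflexive (sym νy≡0)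
    where
    open ≡-Reasoning
    νy≡0 : ν y ≡ fin (+ 0)
    νy≡0 = begin
      ν y               ≡⟨ +∞-identityˡ (ν y) ⟨
      fin (+ 0) +∞ ν y  ≡⟨ cong (_+∞ ν y) (unit⇒ν≡0 𝒪x ¬𝔪x) ⟨
      ν x +∞ ν y        ≡⟨ ν-* x y ⟨
      ν (x * y)         ≡⟨ ν-cong xy≈1 ⟩
      ν 1#              ≡⟨ ν-1# ⟩
      fin (+ 0)         ∎

  𝔪-cancel-unit : ∀ {x y} → 𝒪 x → ¬ 𝔪 x → 𝔪 (x * y) → 𝔪 y
  𝔪-cancel-unit {x} {y} 𝒪x ¬𝔪x = subst (fin (+ 1) ≤∞_) νxy≡νy
    where
    νxy≡νy : ν (x * y) ≡ ν y
    νxy≡νy = trans (ν-* x y) (trans (cong (_+∞ ν y) (unit⇒ν≡0 𝒪x ¬𝔪x)) (+∞-identityˡ (ν y)))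

  rescale : ∀ {π x z} k → ν π ≡ fin (ℤ.- z) → fin (k ℤ.+ z) ≤ν x → fin k ≤ν π * x
  rescale {π} {x} {z} k νπ≡-z k+z≤νx =
    subst (_≤∞ ν (π * x)) (cong fin (-z+[k+z]≡k z k)) (≤ν-* (≤∞-reflexive (sym νπ≡-z)) k+z≤νx)
    where
    -z+[k+z]≡k : ∀ z k → ℤ.- z ℤ.+ (k ℤ.+ z) ≡ k
    -z+[k+z]≡k = ℤ-Solver.solve-∀

  linComb : ∀ {m d} → (Fin m → Carrier) → (Fin m → Fin d → Carrier) → Fin d → Carrier
  linComb μ w c = sum (λ i → μ i * w i c)

  Integral : ∀ {d} → (Fin d → Carrier) → Set
  Integral v = ∀ c → 𝒪 (v c)

  -- A relation of w reduces to a linear dependency between the wᵢ over the residue field 𝒪/𝔪.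
  record Relation {m d} (w : Fin m → Fin d → Carrier) (μ : Fin m → Carrier) : Set where
    constructor relation
    field
      integral : ∀ i → 𝒪 (μ i)
      vanishes : ∀ c → 𝔪 (linComb μ w c)
  open Relation

  Trivial : ∀ {m} → (Fin m → Carrier) → Set
  Trivial μ = ∀ i → 𝔪 (μ i)

  weight : ∀ {m} → (Fin m → Carrier) → ℕ
  weight μ = count (λ i → ¬? (𝔪? (μ i)))

  ResiduallyIndependent : ∀ {m d} → (Fin m → Fin d → Carrier) → Set c
  ResiduallyIndependent w = ∀ μ → Relation w μ → Trivial μ

  ResiduallyIndependent≤ : ∀ {m d} → ℕ → (Fin m → Fin d → Carrier) → Set c
  ResiduallyIndependent≤ l w = ∀ μ → Relation w μ → weight μ ℕ.≤ l → Trivial μ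

  record NontrivialRelation {m d} (w : Fin m → Fin d → Carrier) : Set c where
    field
      coeffs     : Fin m → Carrier
      isRelation : Relation w coeffs
      pivot      : Fin m
      pivot-unit : ¬ 𝔪 (coeffs pivot)

  sum-neg : ∀ {m} (f : Fin m → Carrier) → sum (λ i → - f i) ≈ - sum f
  sum-neg f = begin
    sum (λ i → - f i)        ≈⟨ sum-cong-≋ (λ i → -1*x≈-x (f i)) ⟨
    sum (λ i → - 1# * f i)   ≈⟨ *-distribˡ-sum (- 1#) f ⟨
    - 1# * sum f             ≈⟨ -1*x≈-x (sum f) ⟩
    - sum f                  ∎
    where open ≈-Reasoning

  sum-sub : ∀ {m} (f g : Fin m → Carrier) → sum (λ i → f i - g i) ≈ sum f - sum g
  sum-sub f g = ≈-trans (∑-distrib-+ f (λ i → - g i)) (+-congˡ (sum-neg g))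

  module _ {m d} {w : Fin m → Fin d → Carrier} where

    relation-+ : ∀ {μ μ′} → Relation w μ → Relation w μ′ → Relation w (λ i → μ i + μ′ i)
    relation-+ {μ} {μ′} rμ rμ′ = relation (λ i → ≤ν-+ (integral rμ i) (integral rμ′ i)) λ c →
      ≤ν-resp-≈ (≈-sym (linComb-+ c)) (≤ν-+ (vanishes rμ c) (vanishes rμ′ c))
      where
      linComb-+ : ∀ c → linComb (λ i → μ i + μ′ i) w c ≈ linComb μ w c + linComb μ′ w c
      linComb-+ c = ≈-trans (sum-cong-≋ λ i → distribʳ (w i c) (μ i) (μ′ i))
                            (∑-distrib-+ (λ i → μ i * w i c) (λ i → μ′ i * w i c))

    relation-* : ∀ {a μ} → 𝒪 a → Relation w μ → Relation w (λ i → a * μ i)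
    relation-* {a} {μ} 𝒪a rμ = relation (λ i → 𝒪-* 𝒪a (integral rμ i)) λ c →
      ≤ν-resp-≈ (≈-sym (linComb-* c)) (𝔪-*ʳ 𝒪a (vanishes rμ c))
      where
      linComb-* : ∀ c → linComb (λ i → a * μ i) w c ≈ a * linComb μ w c
      linComb-* c = ≈-trans (sum-cong-≋ λ i → *-assoc a (μ i) (w i c))
                            (≈-sym (*-distribˡ-sum a (λ i → μ i * w i c)))

    relation-cong : ∀ {v μ} → (∀ i c → v i c ≈ w i c) → Relation v μ → Relation w μ
    relation-cong v≈w rμ = relation (integral rμ) λ c →
      ≤ν-resp-≈ (sum-cong-≋ λ i → *-congˡ (v≈w i c)) (vanishes rμ c)

  linComb-insertAt : ∀ {m d} (μ : Fin m → Carrier) J x (w : Fin (suc m) → Fin d → Carrier) c →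
                     linComb (insertAt μ J x) w c ≈ x * w J c + linComb μ (removeAt w J) c
  linComb-insertAt μ J x w c =
    ≈-trans (sum-remove {i = J} (λ k → insertAt μ J x k * w k c))
            (+-cong (*-congʳ (reflexive (insertAt-lookup μ J x)))
                    (sum-cong-≋ λ i → *-congʳ (reflexive (insertAt-punchIn μ J x i))))

  relation-insertAt-0# : ∀ {m d} {w : Fin (suc m) → Fin d → Carrier} {μ} J →
                         Relation (removeAt w J) μ → Relation w (insertAt μ J 0#)
  relation-insertAt-0# {w = w} {μ} J rμ = relation (insertAt-pointwise {P = 𝒪} μ J (≤ν-0# _) (integral rμ)) λ c →
    ≤ν-resp-≈ (≈-sym (linComb-insertAt μ J 0# w c)) (≤ν-+ (≈0⇒≤ν (zeroˡ (w J c))) (vanishes rμ c))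

  independent≤-cong : ∀ {l m d} {v w : Fin m → Fin d → Carrier} →
                      (∀ i c → v i c ≈ w i c) → ResiduallyIndependent≤ l v → ResiduallyIndependent≤ l w
  independent≤-cong v≈w independent μ rμ = independent μ (relation-cong (λ i c → ≈-sym (v≈w i c)) rμ)

  independent≤-cast : ∀ {l m m′ d} {w : Fin m → Fin d → Carrier} (e : m′ ≡ m) →
                      ResiduallyIndependent≤ l w → ResiduallyIndependent≤ l (w ∘ cast e)
  independent≤-cast {w = w} refl =
    independent≤-cong λ i c → reflexive (cong (λ j → w j c) (sym (Fin.cast-is-id refl i)))

  sum-single : ∀ {m} (i : Fin m) (g : Fin m → Carrier) → (∀ k → i ≢ k → g k ≈ 0#) → sum g ≈ g i
  sum-single {suc m} i g off = begin
    sum g                       ≈⟨ sum-remove {i = i} g ⟩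
    g i + sum (removeAt g i)    ≈⟨ +-congˡ (sum-cong-≋ λ j → off (punchIn i j) (punchInᵢ≢i i j ∘ sym)) ⟩
    g i + sum {m} (λ _ → 0#)    ≈⟨ +-congˡ (sum-replicate-zero m) ⟩
    g i + 0#                    ≈⟨ +-identityʳ (g i) ⟩
    g i                         ∎
    where open ≈-Reasoning

  δ : ∀ {m} → Fin m → Fin m → Carrier
  δ i k with i Fin.≟ k
  ... | yes _ = 1#
  ... | no  _ = 0#

  δ-diag : ∀ {m} (i : Fin m) → δ i i ≡ 1#
  δ-diag i with i Fin.≟ i
  ... | yes _  = refl
  ... | no i≢i = ⊥-elim (i≢i refl)

  δ-off : ∀ {m} {i k : Fin m} → i ≢ k → δ i k ≡ 0#
  δ-off {i = i} {k} i≢k with i Fin.≟ k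
  ... | yes i≡k = ⊥-elim (i≢k i≡k)
  ... | no  _   = refl

  𝒪-δ : ∀ {m} (i k : Fin m) → 𝒪 (δ i k)
  𝒪-δ i k with i Fin.≟ k
  ... | yes _ = 𝒪-1#
  ... | no  _ = ≤ν-0# _

  δ-unit : ∀ {m} {i k : Fin m} → ¬ 𝔪 (δ i k) → i ≡ k
  δ-unit {i = i} {k} ¬𝔪 with i Fin.≟ k
  ... | yes i≡k = i≡k
  ... | no  _   = ⊥-elim (¬𝔪 (≤ν-0# _))

  linComb-δ : ∀ {m d} (i : Fin m) (w : Fin m → Fin d → Carrier) c → linComb (δ i) w c ≈ w i c
  linComb-δ i w c =
    ≈-trans (sum-single i _ λ k i≢k → ≈-trans (*-congʳ (reflexive (δ-off i≢k))) (zeroˡ (w k c)))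
            (≈-trans (*-congʳ (reflexive (δ-diag i))) (*-identityˡ (w i c)))

  linComb-basis : ∀ {m} (γ : Fin m → Carrier) c → linComb γ δ c ≈ γ c
  linComb-basis γ c =
    ≈-trans (sum-single c _ λ k c≢k → ≈-trans (*-congˡ (reflexive (δ-off (c≢k ∘ sym)))) (zeroʳ (γ k)))
            (≈-trans (*-congˡ (reflexive (δ-diag c))) (*-identityʳ (γ c)))

  weight-δ : ∀ {m} (i : Fin m) → weight (δ i) ℕ.≤ 1
  weight-δ i = ℕ.≤-trans (count-mono (λ k → ¬? (𝔪? (δ i k))) (i Fin.≟_) (λ k → δ-unit))
                         (count-≤1 (i Fin.≟_) λ i≡k i≡k′ → trans (sym i≡k) i≡k′)

  weight-δ-δ : ∀ {m} (i j : Fin m) → weight (λ k → δ i k - δ j k) ℕ.≤ 2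
  weight-δ-δ i j = ℕ.≤-trans (count-∪ (λ k → ¬? (𝔪? (δ i k - δ j k))) (i Fin.≟_) (j Fin.≟_) unit-position)
                             (ℕ.+-mono-≤ (count-≤1 (i Fin.≟_) λ p q → trans (sym p) q)
                                         (count-≤1 (j Fin.≟_) λ p q → trans (sym p) q))
    where
    unit-position : ∀ k → ¬ 𝔪 (δ i k - δ j k) → i ≡ k ⊎ j ≡ k
    unit-position k ¬𝔪 = decide (i Fin.≟ k) (j Fin.≟ k)
      where
      decide : Dec (i ≡ k) → Dec (j ≡ k) → i ≡ k ⊎ j ≡ k
      decide (yes i≡k) _         = inj₁ i≡k
      decide (no _)    (yes j≡k) = inj₂ j≡k
      decide (no i≢k)  (no j≢k)  = ⊥-elim (¬𝔪 (≈0⇒≤ν (begin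
        δ i k - δ j k   ≈⟨ +-cong (reflexive (δ-off i≢k)) (-‿cong (reflexive (δ-off j≢k))) ⟩
        0# - 0#         ≈⟨ -‿inverseʳ 0# ⟩
        0#              ∎)))
        where open ≈-Reasoning

  -- Nontrivial relations and the pencil bound

  module Pivot {m d} (v : Fin (suc m) → Fin (suc d) → Carrier) (𝒪v : ∀ i → Integral (v i))
               (J : Fin (suc m)) (¬𝔪vJ : ¬ 𝔪 (v J zero)) where

    private
      vJ⁻¹ = unit-inverse (𝒪v J zero) ¬𝔪vJ
      y = proj₁ vJ⁻¹
      yvJ≈1 : y * v J zero ≈ 1#
      yvJ≈1 = ≈-trans (*-comm y (v J zero)) (proj₁ (proj₂ vJ⁻¹))

    factor : Fin m → Carrier
    factor i = v (punchIn J i) zero * y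

    𝒪-factor : ∀ i → 𝒪 (factor i)
    𝒪-factor i = 𝒪-* (𝒪v (punchIn J i) zero) (proj₂ (proj₂ vJ⁻¹))

    eliminated : Fin m → Fin (suc d) → Carrier
    eliminated i c = v (punchIn J i) c - factor i * v J c

    eliminated-0 : ∀ i → eliminated i zero ≈ 0#
    eliminated-0 i = begin
      a - (a * y) * v J zero   ≈⟨ +-congˡ (-‿cong (*-assoc a y (v J zero))) ⟩
      a - a * (y * v J zero)   ≈⟨ +-congˡ (-‿cong (*-congˡ yvJ≈1)) ⟩
      a - a * 1#               ≈⟨ +-congˡ (-‿cong (*-identityʳ a)) ⟩
      a - a                    ≈⟨ -‿inverseʳ a ⟩
      0#                       ∎
      where
      open ≈-Reasoning
      a = v (punchIn J i) zero

    reinsert : (Fin m → Carrier) → Fin (suc m) → Carrier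
    reinsert μ = insertAt μ J (- sum (λ i → μ i * factor i))

    linComb-reinsert : ∀ μ c → linComb (reinsert μ) v c ≈ linComb μ eliminated c
    linComb-reinsert μ c = begin
      linComb (reinsert μ) v c                                     ≈⟨ linComb-insertAt μ J (- X) v c ⟩
      - X * b + linComb μ (removeAt v J) c                         ≈⟨ +-congʳ (-‿distribˡ-* X b) ⟨
      - (X * b) + linComb μ (removeAt v J) c                       ≈⟨ +-comm _ _ ⟩
      linComb μ (removeAt v J) c - X * b                           ≈⟨ +-congˡ (-‿cong Xb≈) ⟩
      linComb μ (removeAt v J) c - sum (λ i → μ i * (factor i * b))  ≈⟨ sum-sub (λ i → μ i * v (punchIn J i) c) _ ⟨
      sum (λ i → μ i * v (punchIn J i) c - μ i * (factor i * b))   ≈⟨ sum-cong-≋ (λ i → x[y-z]≈xy-xz (μ i) _ _) ⟨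
      linComb μ eliminated c                                       ∎
      where
      open ≈-Reasoning
      X = sum (λ i → μ i * factor i)
      b = v J c
      Xb≈ : X * b ≈ sum (λ i → μ i * (factor i * b))
      Xb≈ = ≈-trans (*-distribʳ-sum b (λ i → μ i * factor i)) (sum-cong-≋ λ i → *-assoc (μ i) (factor i) b)

    reduced : Fin m → Fin d → Carrier
    reduced i c = eliminated i (suc c)

    reduced-integral : ∀ i → Integral (reduced i)
    reduced-integral i c = ≤ν-sub (𝒪v (punchIn J i) (suc c)) (𝒪-* (𝒪-factor i) (𝒪v J (suc c)))

    reinsert-relation : ∀ {μ} → Relation reduced μ → Relation v (reinsert μ)
    reinsert-relation {μ} rμ = relation integral′ λ c → ≤ν-resp-≈ (≈-sym (linComb-reinsert μ c)) (vanishes′ c)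
      where
      integral′ : ∀ k → 𝒪 (reinsert μ k)
      integral′ = insertAt-pointwise {P = 𝒪} μ J 𝒪-X (integral rμ)
        where 𝒪-X = ≤ν-neg (≤ν-sum _ λ i → 𝒪-* (integral rμ i) (𝒪-factor i))
      vanishes′ : ∀ c → 𝔪 (linComb μ eliminated c)
      vanishes′ zero    = ≤ν-sum _ λ i → 𝔪-*ʳ (integral rμ i) (≈0⇒≤ν (eliminated-0 i))
      vanishes′ (suc c) = vanishes rμ c

  nontrivial-relation : ∀ {d m} → d ℕ.< m → (v : Fin m → Fin d → Carrier) → (∀ i → Integral (v i)) →
                        NontrivialRelation v
  nontrivial-relation {zero} {suc m} _ v _ = record
    { coeffs = λ _ → 1# ; isRelation = relation (λ _ → 𝒪-1#) (λ ()) ; pivot = zero ; pivot-unit = ¬𝔪-1# }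
  nontrivial-relation {suc d} {suc m} (s≤s d<m) v 𝒪v with any? (λ j → ¬? (𝔪? (v j zero)))
  ... | no ∄unit = record
    { coeffs = coeffs rest ; isRelation = relation (integral (isRelation rest)) vanishes′
    ; pivot = pivot rest ; pivot-unit = pivot-unit rest }
    where
    open NontrivialRelation
    rest = nontrivial-relation (ℕ.m≤n⇒m≤1+n d<m) (λ i c → v i (suc c)) (λ i c → 𝒪v i (suc c))
    vanishes′ : ∀ c → 𝔪 (linComb (coeffs rest) v c)
    vanishes′ zero    = ≤ν-sum _ λ i → 𝔪-*ʳ (integral (isRelation rest) i)
                                           (decidable-stable (𝔪? (v i zero)) λ ¬𝔪 → ∄unit (i , ¬𝔪))
    vanishes′ (suc c) = vanishes (isRelation rest) c
  ... | yes (J , ¬𝔪vJ) = record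
    { coeffs     = reinsert μ
    ; isRelation = reinsert-relation isRelation
    ; pivot      = punchIn J pivot
    ; pivot-unit = subst (¬_ ∘ 𝔪) (sym (insertAt-punchIn μ J _ pivot)) pivot-unit
    }
    where
    open Pivot v 𝒪v J ¬𝔪vJ
    open NontrivialRelation (nontrivial-relation d<m reduced reduced-integral) renaming (coeffs to μ)

  residue-root : ∀ {a b} → 𝒪 a → 𝒪 b → ¬ 𝔪 b → ∃ λ r → 𝔪 (a + residue r * b)
  residue-root {a} {b} 𝒪a 𝒪b ¬𝔪b = r , ≤ν-resp-≈ -[x-ρ]b≈a+ρb (≤ν-neg (𝔪-*ˡ 𝔪x-ρ 𝒪b))
    where
    open ≈-Reasoning
    b⁻¹ = unit-inverse 𝒪b ¬𝔪b
    y = proj₁ b⁻¹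
    x = - (a * y)
    class-of-x = residue-surj x (≤ν-neg (𝒪-* 𝒪a (proj₂ (proj₂ b⁻¹))))
    r = proj₁ class-of-x
    ρ = residue r
    𝔪x-ρ : 𝔪 (x - ρ)
    𝔪x-ρ = proj₂ class-of-x
    xb≈-a : x * b ≈ - a
    xb≈-a = begin
      - (a * y) * b    ≈⟨ -‿distribˡ-* (a * y) b ⟨
      - (a * y * b)    ≈⟨ -‿cong (*-assoc a y b) ⟩
      - (a * (y * b))  ≈⟨ -‿cong (*-congˡ (≈-trans (*-comm y b) (proj₁ (proj₂ b⁻¹)))) ⟩
      - (a * 1#)       ≈⟨ -‿cong (*-identityʳ a) ⟩
      - a              ∎
    -[x-ρ]b≈a+ρb : - ((x - ρ) * b) ≈ a + ρ * b
    -[x-ρ]b≈a+ρb = begin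
      - ((x - ρ) * b)     ≈⟨ -‿cong ([y-z]x≈yx-zx b x ρ) ⟩
      - (x * b - ρ * b)   ≈⟨ ⁻¹-anti-homo‿- (x * b) (ρ * b) ⟩
      ρ * b - x * b       ≈⟨ +-congˡ (-‿cong xb≈-a) ⟩
      ρ * b - - a         ≈⟨ +-congˡ (-‿involutive a) ⟩
      ρ * b + a           ≈⟨ +-comm (ρ * b) a ⟩
      a + ρ * b           ∎

  pencil : ∀ {m} → (Fin m → Carrier) → (Fin m → Carrier) → Fin (suc q) → Fin m → Carrier
  pencil D₁ D₂ zero    k = D₂ k
  pencil D₁ D₂ (suc r) k = D₁ k + residue r * D₂ k

  module _ {m} {D₁ D₂ : Fin m → Carrier} where

    pencil-relation : ∀ {d} {w : Fin m → Fin d → Carrier} →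
                      Relation w D₁ → Relation w D₂ → ∀ t → Relation w (pencil D₁ D₂ t)
    pencil-relation r₁ r₂ zero    = r₂
    pencil-relation r₁ r₂ (suc r) = relation-+ r₁ (relation-* (residue-int r) r₂)

    pencil-nontrivial : ∀ {J k} → D₂ J ≈ 0# → ¬ 𝔪 (D₁ J) → ¬ 𝔪 (D₂ k) →
                        ∀ t → ∃ λ i → ¬ 𝔪 (pencil D₁ D₂ t i)
    pencil-nontrivial {J} {k} D₂J≈0 ¬𝔪D₁J ¬𝔪D₂k zero    = k , ¬𝔪D₂k
    pencil-nontrivial {J} {k} D₂J≈0 ¬𝔪D₁J ¬𝔪D₂k (suc r) = J , ¬𝔪D₁J ∘ ≤ν-resp-≈ D₁J+ρD₂J≈D₁J
      where
      D₁J+ρD₂J≈D₁J : D₁ J + residue r * D₂ J ≈ D₁ J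
      D₁J+ρD₂J≈D₁J = ≈-trans (+-congˡ (≈-trans (*-congˡ D₂J≈0) (zeroʳ _))) (+-identityʳ _)

    pencil-vanishes : ∀ {k} → 𝒪 (D₁ k) → 𝒪 (D₂ k) → ∃ λ t → 𝔪 (pencil D₁ D₂ t k)
    pencil-vanishes {k} 𝒪D₁k 𝒪D₂k with 𝔪? (D₂ k)
    ... | yes 𝔪D₂k = zero , 𝔪D₂k
    ... | no ¬𝔪D₂k = let r , 𝔪 = residue-root 𝒪D₁k 𝒪D₂k ¬𝔪D₂k in suc r , 𝔪

  -- R₁ is a relation avoiding w 0 with a unit at J, R₂ one avoiding w J. Every member of their
  -- pencil is nontrivial, hence of weight > l, yet at every position some member vanishes.
  residual-bound : ∀ {d l} (w : Fin (suc (suc d)) → Fin d → Carrier) → (∀ i → Integral (w i)) →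
                   ResiduallyIndependent≤ l w → suc q ℕ.* suc l ℕ.≤ suc (suc d) ℕ.* q
  residual-bound {d} {l} w 𝒪w independent = double-count (λ t k → ¬? (𝔪? (C t k))) heavy vanishing
    where
    open NontrivialRelation
    R₁ = nontrivial-relation (ℕ.n<1+n d) (removeAt w zero) (𝒪w ∘ punchIn zero)
    J = punchIn zero (pivot R₁)
    R₂ = nontrivial-relation (ℕ.n<1+n d) (removeAt w J) (𝒪w ∘ punchIn J)
    D₁ = insertAt (coeffs R₁) zero 0#
    D₂ = insertAt (coeffs R₂) J 0#
    C = pencil D₁ D₂
    rel₁ = relation-insertAt-0# zero (isRelation R₁)
    rel₂ = relation-insertAt-0# J (isRelation R₂)
    heavy : ∀ t → suc l ℕ.≤ weight (C t)
    heavy t = ℕ.≰⇒> λ light → let k , ¬𝔪 = nontrivial t in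
      ¬𝔪 (independent (C t) (pencil-relation rel₁ rel₂ t) light k)
      where
      nontrivial = pencil-nontrivial {J = J} {k = punchIn J (pivot R₂)}
                     (reflexive (insertAt-lookup (coeffs R₂) J 0#)) (pivot-unit R₁)
                     (subst (¬_ ∘ 𝔪) (sym (insertAt-punchIn (coeffs R₂) J 0# (pivot R₂))) (pivot-unit R₂))
    vanishing : ∀ k → ∃ λ t → ¬ ¬ 𝔪 (C t k)
    vanishing k = let t , 𝔪Ctk = pencil-vanishes (integral rel₁ k) (integral rel₂ k) in t , λ ¬𝔪 → ¬𝔪 𝔪Ctk

  module _ {a} {A : Set a} where

    restrict-𝔪 : ∀ {d} {xs ys : List A} (p : xs ⊆ ys) {w : Fin (length ys) → Fin d → Carrier} {μ} →
                 (∀ i → Integral (w i)) → (∀ i → ¬ 𝔪 (μ i) → ∃ λ j → embed p j ≡ i) →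
                 ∀ c x → 𝔪 (x + linComb μ w c) → 𝔪 (x + linComb (μ ∘ embed p) (w ∘ embed p) c)
    restrict-𝔪 []                 𝒪w covers c x 𝔪x+μw = 𝔪x+μw
    restrict-𝔪 (y ∷ʳ p) {w} {μ}   𝒪w covers c x 𝔪x+μw =
      restrict-𝔪 p (𝒪w ∘ suc) (λ i ¬𝔪 → let j , eq = covers (suc i) ¬𝔪 in j , Fin.suc-injective eq) c x
        (𝔪-cancelˡ (≤ν-resp-≈ (x∙yz≈y∙xz x _ _) 𝔪x+μw) (𝔪-*ˡ 𝔪μ₀ (𝒪w zero c)))
      where
      𝔪μ₀ : 𝔪 (μ zero)
      𝔪μ₀ = decidable-stable (𝔪? (μ zero)) λ ¬𝔪 → let j , eq = covers zero ¬𝔪 in suc≢zero eq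
        where
        suc≢zero : ∀ {n} {j : Fin n} → suc j ≢ zero
        suc≢zero ()
    restrict-𝔪 (refl ∷ p) {w} {μ} 𝒪w covers c x 𝔪x+μw =
      ≤ν-resp-≈ (+-assoc x _ _)
        (restrict-𝔪 p (𝒪w ∘ suc) covers′ c (x + μ zero * w zero c)
          (≤ν-resp-≈ (≈-sym (+-assoc x _ _)) 𝔪x+μw))
      where
      covers′ : ∀ i → ¬ 𝔪 (μ (suc i)) → ∃ λ j → embed p j ≡ i
      covers′ i ¬𝔪 with covers (suc i) ¬𝔪
      ... | suc j , eq = j , Fin.suc-injective eq

    relation-restrict : ∀ {d} {xs ys : List A} (p : xs ⊆ ys) {w : Fin (length ys) → Fin d → Carrier} {μ} →
                        (∀ i → Integral (w i)) → (∀ i → ¬ 𝔪 (μ i) → ∃ λ j → embed p j ≡ i) →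
                        Relation w μ → Relation (w ∘ embed p) (μ ∘ embed p)
    relation-restrict p 𝒪w covers rμ = relation (integral rμ ∘ embed p) λ c →
      ≤ν-resp-≈ (+-identityˡ _)
        (restrict-𝔪 p 𝒪w covers c 0# (≤ν-resp-≈ (≈-sym (+-identityˡ _)) (vanishes rμ c)))

    extend : ∀ {xs ys : List A} → xs ⊆ ys → (Fin (length xs) → Carrier) → Fin (length ys) → Carrier
    extend (y ∷ʳ p)   μ zero    = 0#
    extend (y ∷ʳ p)   μ (suc i) = extend p μ i
    extend (refl ∷ p) μ zero    = μ zero
    extend (refl ∷ p) μ (suc i) = extend p (μ ∘ suc) i

    extend-embed : ∀ {xs ys : List A} (p : xs ⊆ ys) μ j → extend p μ (embed p j) ≡ μ j
    extend-embed (y ∷ʳ p)   μ j       = extend-embed p μ j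
    extend-embed (refl ∷ p) μ zero    = refl
    extend-embed (refl ∷ p) μ (suc j) = extend-embed p (μ ∘ suc) j

    weight-extend : ∀ {xs ys : List A} (p : xs ⊆ ys) μ → weight (extend p μ) ≡ weight μ
    weight-extend []         μ = refl
    weight-extend (y ∷ʳ p)   μ =
      cong₂ ℕ._+_ (indicator-¬ (λ ¬𝔪0 → ¬𝔪0 (≤ν-0# _)) (¬? (𝔪? 0#))) (weight-extend p μ)
    weight-extend (refl ∷ p) μ = cong (ℕ._+_ (indicator (¬? (𝔪? (μ zero))))) (weight-extend p (μ ∘ suc))

    relation-extend : ∀ {d} {xs ys : List A} (p : xs ⊆ ys) {w : Fin (length ys) → Fin d → Carrier} {μ} →
                      Relation (w ∘ embed p) μ → Relation w (extend p μ)
    relation-extend {d} p {w} {μ} rμ = relation (integral′ p (integral rμ)) λ c →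
      ≤ν-resp-≈ (≈-sym (linComb-extend p μ w c)) (vanishes rμ c)
      where
      integral′ : ∀ {xs ys : List A} (p : xs ⊆ ys) {μ} → (∀ j → 𝒪 (μ j)) → ∀ i → 𝒪 (extend p μ i)
      integral′ (y ∷ʳ p)   𝒪μ zero    = ≤ν-0# _
      integral′ (y ∷ʳ p)   𝒪μ (suc i) = integral′ p 𝒪μ i
      integral′ (refl ∷ p) 𝒪μ zero    = 𝒪μ zero
      integral′ (refl ∷ p) 𝒪μ (suc i) = integral′ p (𝒪μ ∘ suc) i
      linComb-extend : ∀ {xs ys : List A} (p : xs ⊆ ys) μ (w : Fin (length ys) → Fin d → Carrier) c →
                       linComb (extend p μ) w c ≈ linComb μ (w ∘ embed p) c
      linComb-extend []         μ w c = ≈-refl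
      linComb-extend (y ∷ʳ p)   μ w c =
        ≈-trans (+-congʳ (zeroˡ (w zero c))) (≈-trans (+-identityˡ _) (linComb-extend p μ (w ∘ suc) c))
      linComb-extend (refl ∷ p) μ w c = +-congˡ (linComb-extend p (μ ∘ suc) (w ∘ suc) c)

  -- Orthogonality

  module Dimension (n : ℕ) where
    open Orthogonality K n

    ν‖‖-cong : ∀ {u v : Vecⁿ} → (∀ c → u c ≈ v c) → ν‖ u ‖ ≡ ν‖ v ‖
    ν‖‖-cong u≈v = minF-cong n (λ c → ν-cong (u≈v c))

    ν‖•‖ : ∀ a v → ν‖ a • v ‖ ≡ ν a +∞ ν‖ v ‖
    ν‖•‖ a v = trans (minF-cong n (λ c → ν-* a (v c))) (minF-+∞ n (ν a) (λ c → ν (v c)))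

    Normalised : ∀ {m} → (Fin m → Vecⁿ) → Set
    Normalised w = ∀ i → ν‖ w i ‖ ≡ fin (+ 0)

    normalised⇒integral : ∀ {v} → ν‖ v ‖ ≡ fin (+ 0) → Integral v
    normalised⇒integral ν‖v‖≡0 c = ≤∞-trans (≤∞-reflexive (sym ν‖v‖≡0)) (minF-≤ n _ c)

    OrthogonalFamily : ∀ {m} → (Fin m → Vecⁿ) → Set c
    OrthogonalFamily {m} w = ∀ λs → ν‖ linComb λs w ‖ ≡ minF m (λ i → ν‖ λs i • w i ‖)

    Orthogonal⇔OrthogonalFamily : ∀ us → Orthogonal us ⇔ OrthogonalFamily (lookup us)
    Orthogonal⇔OrthogonalFamily us = mk⇔
      (λ orth λs → trans (sym (lincomb≡ λs)) (trans (orth λs) (scaled≡ λs)))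
      (λ orth λs → trans (lincomb≡ λs) (trans (orth λs) (sym (scaled≡ λs))))
      where
      lincomb-lookup : ∀ us λs c → lincomb us λs c ≡ linComb λs (lookup us) c
      lincomb-lookup []       λs c = refl
      lincomb-lookup (u ∷ us) λs c = cong (_+_ (λs zero * u c)) (lincomb-lookup us (λs ∘ suc) c)
      scaled-lookup : ∀ us λs i → scaled us λs i ≡ λs i • lookup us i
      scaled-lookup (u ∷ us) λs zero    = refl
      scaled-lookup (u ∷ us) λs (suc i) = scaled-lookup us (λs ∘ suc) i
      lincomb≡ : ∀ λs → ν‖ lincomb us λs ‖ ≡ ν‖ linComb λs (lookup us) ‖
      lincomb≡ λs = minF-cong n (λ c → cong ν (lincomb-lookup us λs c))
      scaled≡ : ∀ λs → minF (length us) (λ i → ν‖ scaled us λs i ‖)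
                     ≡ minF (length us) (λ i → ν‖ λs i • lookup us i ‖)
      scaled≡ λs = minF-cong (length us) (λ i → cong ν‖_‖ (scaled-lookup us λs i))

    module _ {m} {w : Fin m → Vecⁿ} (normalised : Normalised w) where

      ν‖λw‖≡νλ : ∀ (λs : Fin m → Carrier) i → ν‖ λs i • w i ‖ ≡ ν (λs i)
      ν‖λw‖≡νλ λs i =
        trans (ν‖•‖ (λs i) (w i)) (trans (cong (ν (λs i) +∞_) (normalised i)) (+∞-identityʳ (ν (λs i))))

      orthogonal⇒independent : OrthogonalFamily w → ResiduallyIndependent w
      orthogonal⇒independent orth μ rμ i = subst (fin (+ 1) ≤∞_) (ν‖λw‖≡νλ μ i) (begin
        fin (+ 1)                            ∼⟨ minF-glb n _ (vanishes rμ) ⟩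
        ν‖ linComb μ w ‖                     ≡⟨ orth μ ⟩
        minF m (λ j → ν‖ μ j • w j ‖)        ∼⟨ minF-≤ m _ i ⟩
        ν‖ μ i • w i ‖                       ∎)
        where open ≤∞-Reasoning

      -- If ‖Σ λᵢ wᵢ‖ were smaller than maxᵢ |λᵢ| = |λ i₀|, scaling λ by π with |π λ i₀| = 1 would
      -- turn it into a relation with the unit coefficient π λ i₀.
      independent⇒orthogonal : ResiduallyIndependent w → OrthogonalFamily w
      independent⇒orthogonal independent λs =
        trans (≤∞-antisym upper lower) (sym (minF-cong m (ν‖λw‖≡νλ λs)))
        where
        L = minF m (λ i → ν (λs i))
        lower : L ≤∞ ν‖ linComb λs w ‖
        lower = minF-glb n _ λ c → ≤ν-sum _ λ i →
          subst (_≤∞ ν (λs i * w i c)) (+∞-identityʳ L)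
            (≤ν-* (minF-≤ m _ i) (normalised⇒integral (normalised i) c))
        upper-at : ∀ i₀ → L ≡ ν (λs i₀) → ν‖ linComb λs w ‖ ≤∞ L
        upper-at i₀ L≡νλi₀ with ν (λs i₀) in νλi₀≡
        ... | ∞     = subst (ν‖ linComb λs w ‖ ≤∞_) (sym L≡νλi₀) (_ ≤∞∞)
        ... | fin z with ν‖ linComb λs w ‖ ≤∞? fin z
        ...   | yes ≤z = subst (ν‖ linComb λs w ‖ ≤∞_) (sym L≡νλi₀) ≤z
        ...   | no  ≰z = ⊥-elim (ν≡0⇒¬𝔪 νμi₀≡0 (independent μ (relation 𝒪μ 𝔪μw) i₀))
          where
          π = proj₁ (ν-surj (ℤ.- z))
          νπ≡-z = proj₂ (ν-surj (ℤ.- z))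
          μ : Fin m → Carrier
          μ i = π * λs i
          𝒪μ : ∀ i → 𝒪 (μ i)
          𝒪μ i = rescale (+ 0) νπ≡-z (subst (λ t → fin t ≤∞ ν (λs i)) (sym (ℤ.+-identityˡ z))
                   (≤∞-trans (≤∞-reflexive (sym L≡νλi₀)) (minF-≤ m _ i)))
          𝔪μw : ∀ c → 𝔪 (linComb μ w c)
          𝔪μw c = ≤ν-resp-≈ πΣ≈Σπ (rescale (+ 1) νπ≡-z (≤∞-trans (≰∞⇒suc≤∞ ≰z) (minF-≤ n _ c)))
            where
            πΣ≈Σπ : π * linComb λs w c ≈ linComb μ w c
            πΣ≈Σπ = ≈-trans (*-distribˡ-sum π (λ i → λs i * w i c)) (sum-cong-≋ λ i → ≈-sym (*-assoc π (λs i) (w i c)))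
          νμi₀≡0 : ν (μ i₀) ≡ fin (+ 0)
          νμi₀≡0 = trans (ν-* π (λs i₀)) (trans (cong₂ _+∞_ νπ≡-z νλi₀≡) (cong fin (ℤ.+-inverseˡ z)))
        upper : ν‖ linComb λs w ‖ ≤∞ L
        upper with minF-attained m (λ i → ν (λs i))
        ... | inj₁ L≡∞         = subst (ν‖ linComb λs w ‖ ≤∞_) (sym L≡∞) (_ ≤∞∞)
        ... | inj₂ (i₀ , L≡νλi₀) = upper-at i₀ L≡νλi₀

    orthogonal-rescale : ∀ {m} {u v : Fin m → Vecⁿ} (π : Fin m → Carrier) →
                         (∀ i c → v i c ≈ π i * u i c) → OrthogonalFamily u → OrthogonalFamily v
    orthogonal-rescale {m} {u} {v} π v≈πu orth λs = begin
      ν‖ linComb λs v ‖                       ≡⟨ ν‖‖-cong (λ c → sum-cong-≋ λ i → λv≈λπu i c) ⟩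
      ν‖ linComb (λ i → λs i * π i) u ‖       ≡⟨ orth (λ i → λs i * π i) ⟩
      minF m (λ i → ν‖ (λs i * π i) • u i ‖)  ≡⟨ minF-cong m (λ i → ν‖‖-cong λ c → ≈-sym (λv≈λπu i c)) ⟩
      minF m (λ i → ν‖ λs i • v i ‖)          ∎
      where
      open ≡-Reasoning
      λv≈λπu : ∀ i c → λs i * v i c ≈ (λs i * π i) * u i c
      λv≈λπu i c = ≈-trans (*-congˡ (v≈πu i c)) (≈-sym (*-assoc _ _ _))

    ν‖0‖ : ∀ {u} → u ≈ᵛ 0ᵛ → ν‖ u ‖ ≡ ∞
    ν‖0‖ u≈0 = trans (minF-cong n (λ c → trans (ν-cong (u≈0 c)) ν-0)) (minF-∞ n)

    scaleToUnit : ℤ∞ → Carrier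
    scaleToUnit (fin z) = proj₁ (ν-surj (ℤ.- z))
    scaleToUnit ∞       = 1#  -- junk value: only nonzero vectors are normalised

    normalise : Vecⁿ → Vecⁿ
    normalise u = scaleToUnit ν‖ u ‖ • u

    normalise-normalised : ∀ {u} → ¬ u ≈ᵛ 0ᵛ → ν‖ normalise u ‖ ≡ fin (+ 0)
    normalise-normalised {u} u≉0 = trans (ν‖•‖ _ u) (cancel ν‖ u ‖ refl)
      where
      cancel : ∀ x → ν‖ u ‖ ≡ x → ν (scaleToUnit x) +∞ x ≡ fin (+ 0)
      cancel ∞       ν‖u‖≡∞ =
        ⊥-elim (u≉0 λ c → ν-∞⇒0 (u c) (∞≤∞⇒≡∞ (≤∞-trans (≤∞-reflexive (sym ν‖u‖≡∞)) (minF-≤ n _ c))))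
      cancel (fin z) _      = trans (cong (_+∞ fin z) (proj₂ (ν-surj (ℤ.- z)))) (cong fin (ℤ.+-inverseˡ z))

    KLOrthogonal-⊆ : ∀ {k l S S′} → S′ ⊆ S → KLOrthogonal k l S → KLOrthogonal k l S′
    KLOrthogonal-⊆ S′⊆S ((distinct , nonzero) , orthogonal-subsets) =
      (AllPairs-resp-⊆ S′⊆S distinct , All-resp-⊆ S′⊆S nonzero) ,
      λ T T⊆S′ → orthogonal-subsets T (⊆-trans T⊆S′ S′⊆S)

    KLOrthogonal⇒normalised : ∀ {k l} S → KLOrthogonal k l S → Normalised (normalise ∘ lookup S)
    KLOrthogonal⇒normalised S ((_ , nonzero) , _) i = normalise-normalised (All.lookup nonzero (∈-lookup i))

    KLOrthogonal⇒independent≤ : ∀ {l} S → KLOrthogonal l l S → l ℕ.≤ length S →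
                                 ResiduallyIndependent≤ l (normalise ∘ lookup S)
    KLOrthogonal⇒independent≤ {l} S orthogonal@(_ , orthogonal-subsets) l≤|S| μ rμ weight≤l i with 𝔪? (μ i)
    ... | yes 𝔪μi = 𝔪μi
    ... | no ¬𝔪μi = let j , embed≡i = covers i ¬𝔪μi in
      subst (𝔪 ∘ μ) embed≡i (independent-sub (μ ∘ embed sub⊆ys) (relation-restrict sub⊆ys 𝒪w covers rμ) j)
      where
      open Covering (cover S (λ i → ¬? (𝔪? (μ i))) l weight≤l l≤|S|)
      w = normalise ∘ lookup S
      normalised : Normalised w
      normalised = KLOrthogonal⇒normalised S orthogonal
      𝒪w : ∀ i → Integral (w i)
      𝒪w i = normalised⇒integral (normalised i)
      sub-orthogonal : Orthogonal sub
      sub-orthogonal with orthogonal-subsets sub sub⊆ys length≡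
      ... | U , U⊆sub , |U|≡l , orthogonal-U =
        subst Orthogonal (Pointwise-≡⇒≡ (toPointwise (trans |U|≡l (sym length≡)) U⊆sub)) orthogonal-U
      independent-sub : ResiduallyIndependent (w ∘ embed sub⊆ys)
      independent-sub = orthogonal⇒independent (normalised ∘ embed sub⊆ys)
        (orthogonal-rescale (λ j → scaleToUnit ν‖ lookup S (embed sub⊆ys j) ‖)
           (λ j c → *-congˡ (reflexive (cong (λ v → v c) (sym (lookup-embed sub⊆ys j)))))
           (Equivalence.to (Orthogonal⇔OrthogonalFamily sub) sub-orthogonal))

    module _ {l m} {w : Fin m → Vecⁿ} (independent : ResiduallyIndependent≤ l w) where

      independent≤⇒normalised : 1 ℕ.≤ l → (∀ i → Integral (w i)) → Normalised w
      independent≤⇒normalised 1≤l 𝒪w i with ν‖ w i ‖ ≤∞? fin (+ 0)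
      ... | yes ≤0 = ≤∞-antisym ≤0 (minF-glb n _ (𝒪w i))
      ... | no  ≰0 =
        ⊥-elim (¬𝔪-1# (subst 𝔪 (δ-diag i) (independent (δ i) δ-relation (ℕ.≤-trans (weight-δ i) 1≤l) i)))
        where
        δ-relation : Relation w (δ i)
        δ-relation = relation (𝒪-δ i) λ c →
          ≤ν-resp-≈ (≈-sym (linComb-δ i w c)) (≤∞-trans (≰∞⇒suc≤∞ ≰0) (minF-≤ n _ c))

      independent≤⇒distinct : 2 ℕ.≤ l → ∀ {i j} → i ≢ j → ¬ w i ≈ᵛ w j
      independent≤⇒distinct 2≤l {i} {j} i≢j wi≈wj =
        ¬𝔪-1# (≤ν-resp-≈ μi≈1 (independent μ μ-relation (ℕ.≤-trans (weight-δ-δ i j) 2≤l) i))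
        where
        open ≈-Reasoning
        μ : Fin m → Carrier
        μ k = δ i k - δ j k
        μi≈1 : μ i ≈ 1#
        μi≈1 = begin
          δ i i - δ j i   ≈⟨ +-cong (reflexive (δ-diag i)) (-‿cong (reflexive (δ-off (i≢j ∘ sym)))) ⟩
          1# - 0#         ≈⟨ +-congˡ -0#≈0# ⟩
          1# + 0#         ≈⟨ +-identityʳ 1# ⟩
          1#              ∎
        μw≈0 : ∀ c → linComb μ w c ≈ 0#
        μw≈0 c = begin
          linComb μ w c                                ≈⟨ sum-cong-≋ (λ k → [y-z]x≈yx-zx (w k c) _ _) ⟩
          sum (λ k → δ i k * w k c - δ j k * w k c)    ≈⟨ sum-sub (λ k → δ i k * w k c) _ ⟩
          linComb (δ i) w c - linComb (δ j) w c        ≈⟨ +-cong (linComb-δ i w c) (-‿cong (linComb-δ j w c)) ⟩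
          w i c - w j c                                ≈⟨ +-congʳ (wi≈wj c) ⟩
          w j c - w j c                                ≈⟨ -‿inverseʳ (w j c) ⟩
          0#                                           ∎
        μ-relation : Relation w μ
        μ-relation = relation (λ k → ≤ν-sub (𝒪-δ i k) (𝒪-δ j k)) (λ c → ≈0⇒≤ν (μw≈0 c))

    independent≤⇒sublists-orthogonal : ∀ {l} S → Normalised (lookup S) → ResiduallyIndependent≤ l (lookup S) →
                                        ∀ T → T ⊆ S → length T ≡ l → Orthogonal T
    independent≤⇒sublists-orthogonal {l} S normalised independent T T⊆S |T|≡l =
      Equivalence.from (Orthogonal⇔OrthogonalFamily T) (independent⇒orthogonal normalised-T independent-T)
      where
      normalised-T : Normalised (lookup T)
      normalised-T j = trans (cong ν‖_‖ (lookup-embed T⊆S j)) (normalised (embed T⊆S j))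
      independent-T : ResiduallyIndependent (lookup T)
      independent-T μ rμ j = subst 𝔪 (extend-embed T⊆S μ j)
        (independent (extend T⊆S μ) (relation-extend T⊆S {w = lookup S} (relation-cong lookup-T≈ rμ))
                     weight≤l (embed T⊆S j))
        where
        lookup-T≈ : ∀ j c → lookup T j c ≈ lookup S (embed T⊆S j) c
        lookup-T≈ j c = reflexive (cong (λ v → v c) (lookup-embed T⊆S j))
        weight≤l : weight (extend T⊆S μ) ℕ.≤ l
        weight≤l = subst (ℕ._≤ l) (sym (weight-extend T⊆S μ)) (subst (weight μ ℕ.≤_) |T|≡l (count≤ _))

    independent≤⇒KLOrthogonal : ∀ {l m} (w : Fin m → Vecⁿ) → 2 ℕ.≤ l → (∀ i → Integral (w i)) →
                                 ResiduallyIndependent≤ l w → KLOrthogonal l l (tabulate w)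
    independent≤⇒KLOrthogonal w 2≤l 𝒪w independent =
      (AllPairs.tabulate⁺ (independent≤⇒distinct independent 2≤l) , All.tabulate⁺ nonzero) ,
      λ T T⊆S |T|≡l → T , ⊆-refl , |T|≡l ,
        independent≤⇒sublists-orthogonal (tabulate w) normalised-S independent-S T T⊆S |T|≡l
      where
      normalised : Normalised w
      normalised = independent≤⇒normalised independent (ℕ.≤-trans (s≤s z≤n) 2≤l) 𝒪w
      nonzero : ∀ i → ¬ w i ≈ᵛ 0ᵛ
      nonzero i wi≈0 with trans (sym (normalised i)) (ν‖0‖ wi≈0)
      ... | ()
      normalised-S : Normalised (lookup (tabulate w))
      normalised-S j = trans (cong ν‖_‖ (lookup-tabulate-cast w j)) (normalised _)
      independent-S : ResiduallyIndependent≤ _ (lookup (tabulate w))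
      independent-S = independent≤-cong (λ j c → reflexive (cong (λ v → v c) (sym (lookup-tabulate-cast w j))))
                                        (independent≤-cast (length-tabulate w) independent)

  onesAndBasis : ∀ {n} → Fin (suc n) → Fin n → Carrier
  onesAndBasis zero    c = 1#
  onesAndBasis (suc k) c = δ k c

  onesAndBasis-integral : ∀ {n} i → Integral (onesAndBasis {n} i)
  onesAndBasis-integral zero    c = 𝒪-1#
  onesAndBasis-integral (suc k) c = 𝒪-δ k c

  onesAndBasis-independent≤ : ∀ {n l} → l ℕ.≤ n → ResiduallyIndependent≤ l (onesAndBasis {n})
  onesAndBasis-independent≤ {n} l≤n μ rμ weight≤l = by-cases (𝔪? (μ zero))
    where
    𝔪μ₀+μc : ∀ c → 𝔪 (μ zero + μ (suc c))
    𝔪μ₀+μc c = ≤ν-resp-≈ (+-cong (*-identityʳ (μ zero)) (linComb-basis (μ ∘ suc) c)) (vanishes rμ c)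
    by-cases : Dec (𝔪 (μ zero)) → Trivial μ
    by-cases (yes 𝔪μ₀) zero    = 𝔪μ₀
    by-cases (yes 𝔪μ₀) (suc c) = 𝔪-cancelˡ (𝔪μ₀+μc c) 𝔪μ₀
    by-cases (no ¬𝔪μ₀) =
      ⊥-elim (ℕ.1+n≰n (ℕ.≤-trans (ℕ.≤-reflexive (sym all-units)) (ℕ.≤-trans weight≤l l≤n)))
      where
      unit : ∀ i → ¬ 𝔪 (μ i)
      unit zero    = ¬𝔪μ₀
      unit (suc c) = ¬𝔪μ₀ ∘ 𝔪-cancelʳ (𝔪μ₀+μc c)
      all-units : weight μ ≡ suc n
      all-units = count-all (λ i → ¬? (𝔪? (μ i))) unit

  -- (U t : V t) runs through the q + 1 points (1 : 0), (ρ r : 1) of the projective line over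
  -- 𝒪/𝔪; U vanishes only at t = 1 (as ρ 0 ≡ 0) and V only at t = 0. The n + 2 items (the vectors
  -- of U and of V, then the basis) get the class i mod (q + 1), and the coordinate c of the two
  -- special vectors is the point of class c + 2. Then the non-unit coefficients of a nontrivial
  -- relation lie in a single class, which has at most ⌈(n + 2)/(q + 1)⌉ items.
  module LineFamily {Q} (ρ : Fin (suc Q) → Carrier) (𝒪ρ : ∀ r → 𝒪 (ρ r))
                    (ρ-incongruent : ∀ r s → 𝔪 (ρ r - ρ s) → r ≡ s) (𝔪ρ₀ : 𝔪 (ρ zero)) {n : ℕ} where

    d : ℕ
    d = suc (suc Q)

    U V : Fin d → Carrier
    U zero    = 1#
    U (suc r) = ρ r
    V zero    = 0#
    V (suc r) = 1#

    𝒪U : ∀ t → 𝒪 (U t)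
    𝒪U zero    = 𝒪-1#
    𝒪U (suc r) = 𝒪ρ r

    𝒪V : ∀ t → 𝒪 (V t)
    𝒪V zero    = ≤ν-0# _
    𝒪V (suc r) = 𝒪-1#

    U-vanishes : ∀ {t} → 𝔪 (U t) → t ≡ suc zero
    U-vanishes {zero}  𝔪1  = ⊥-elim (¬𝔪-1# 𝔪1)
    U-vanishes {suc r} 𝔪ρr = cong suc (ρ-incongruent r zero (≤ν-sub 𝔪ρr 𝔪ρ₀))

    V-vanishes : ∀ {t} → 𝔪 (V t) → t ≡ zero
    V-vanishes {zero}  _  = refl
    V-vanishes {suc r} 𝔪1 = ⊥-elim (¬𝔪-1# 𝔪1)

    α1+β0≈α : ∀ α β → α * 1# + β * 0# ≈ α
    α1+β0≈α α β = ≈-trans (+-cong (*-identityʳ α) (zeroʳ β)) (+-identityʳ α)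

    pairing-unique : ∀ {α β} → 𝒪 α → ¬ 𝔪 α → ¬ 𝔪 β → ∀ {t t′} →
                     𝔪 (α * U t + β * V t) → 𝔪 (α * U t′ + β * V t′) → t ≡ t′
    pairing-unique {α} {β} 𝒪α ¬𝔪α ¬𝔪β {zero}  𝔪α+β0 _     = ⊥-elim (¬𝔪α (≤ν-resp-≈ (α1+β0≈α α β) 𝔪α+β0))
    pairing-unique {α} {β} 𝒪α ¬𝔪α ¬𝔪β {suc r} {zero} _ 𝔪α+β0 = ⊥-elim (¬𝔪α (≤ν-resp-≈ (α1+β0≈α α β) 𝔪α+β0))
    pairing-unique {α} {β} 𝒪α ¬𝔪α ¬𝔪β {suc r} {suc r′} 𝔪αρ+β 𝔪αρ′+β =
      cong suc (ρ-incongruent r r′ (𝔪-cancel-unit 𝒪α ¬𝔪α (≤ν-resp-≈ difference (≤ν-sub 𝔪αρ+β 𝔪αρ′+β))))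
      where
      open ≈-Reasoning
      difference : (α * ρ r + β * 1#) - (α * ρ r′ + β * 1#) ≈ α * (ρ r - ρ r′)
      difference = begin
        (α * ρ r + β * 1#) - (α * ρ r′ + β * 1#)           ≈⟨ +-congˡ (-‿+-comm (α * ρ r′) (β * 1#)) ⟨
        (α * ρ r + β * 1#) + (- (α * ρ r′) + - (β * 1#))   ≈⟨ interchange (α * ρ r) (β * 1#) _ _ ⟩
        (α * ρ r - α * ρ r′) + (β * 1# - β * 1#)           ≈⟨ +-congˡ (-‿inverseʳ (β * 1#)) ⟩
        (α * ρ r - α * ρ r′) + 0#                          ≈⟨ +-identityʳ _ ⟩
        α * ρ r - α * ρ r′                                 ≈⟨ x[y-z]≈xy-xz α (ρ r) (ρ r′) ⟨
        α * (ρ r - ρ r′)                                   ∎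

    class : Fin (suc (suc n)) → Fin d
    class i = toℕ i mod d

    coordinateClass : Fin n → Fin d
    coordinateClass c = class (suc (suc c))

    lineFamily : Fin (suc (suc n)) → Fin n → Carrier
    lineFamily zero          c = U (coordinateClass c)
    lineFamily (suc zero)    c = V (coordinateClass c)
    lineFamily (suc (suc k)) c = δ k c

    lineFamily-integral : ∀ i → Integral (lineFamily i)
    lineFamily-integral zero          c = 𝒪U (coordinateClass c)
    lineFamily-integral (suc zero)    c = 𝒪V (coordinateClass c)
    lineFamily-integral (suc (suc k)) c = 𝒪-δ k c

    module _ {μ} (rμ : Relation lineFamily μ) where
      private
        α = μ zero
        β = μ (suc zero)
        γ : Fin n → Carrier
        γ c = μ (suc (suc c))
        W : Fin n → Carrier
        W c = α * U (coordinateClass c) + β * V (coordinateClass c)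
        𝔪W+γ : ∀ c → 𝔪 (W c + γ c)
        𝔪W+γ c = ≤ν-resp-≈ (≈-trans (+-congˡ (+-congˡ (linComb-basis γ c))) (≈-sym (+-assoc _ _ _)))
                           (vanishes rμ c)
        𝔪γ⇒𝔪W : ∀ c → 𝔪 (γ c) → 𝔪 (W c)
        𝔪γ⇒𝔪W c = 𝔪-cancelʳ (𝔪W+γ c)

      trivial-if-𝔪 : 𝔪 α → 𝔪 β → Trivial μ
      trivial-if-𝔪 𝔪α 𝔪β zero          = 𝔪α
      trivial-if-𝔪 𝔪α 𝔪β (suc zero)    = 𝔪β
      trivial-if-𝔪 𝔪α 𝔪β (suc (suc c)) =
        𝔪-cancelˡ (𝔪W+γ c) (≤ν-+ (𝔪-*ˡ 𝔪α (𝒪U (coordinateClass c))) (𝔪-*ˡ 𝔪β (𝒪V (coordinateClass c))))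

      nonunits-where-U-vanishes : ¬ 𝔪 α → 𝔪 β → ∀ i → 𝔪 (μ i) → class i ≡ suc zero
      nonunits-where-U-vanishes ¬𝔪α 𝔪β zero          𝔪α = ⊥-elim (¬𝔪α 𝔪α)
      nonunits-where-U-vanishes ¬𝔪α 𝔪β (suc zero)    _  = refl
      nonunits-where-U-vanishes ¬𝔪α 𝔪β (suc (suc c)) 𝔪γ =
        U-vanishes (𝔪-cancel-unit (integral rμ zero) ¬𝔪α (𝔪-cancelʳ (𝔪γ⇒𝔪W c 𝔪γ) (𝔪-*ˡ 𝔪β (𝒪V (coordinateClass c)))))

      nonunits-where-V-vanishes : 𝔪 α → ¬ 𝔪 β → ∀ i → 𝔪 (μ i) → class i ≡ zero
      nonunits-where-V-vanishes 𝔪α ¬𝔪β zero          _  = refl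
      nonunits-where-V-vanishes 𝔪α ¬𝔪β (suc zero)    𝔪β = ⊥-elim (¬𝔪β 𝔪β)
      nonunits-where-V-vanishes 𝔪α ¬𝔪β (suc (suc c)) 𝔪γ =
        V-vanishes (𝔪-cancel-unit (integral rμ (suc zero)) ¬𝔪β (𝔪-cancelˡ (𝔪γ⇒𝔪W c 𝔪γ) (𝔪-*ˡ 𝔪α (𝒪U (coordinateClass c)))))

      nonunits-in-one-class : ¬ 𝔪 α → ¬ 𝔪 β → ∃ λ t → ∀ i → 𝔪 (μ i) → class i ≡ t
      nonunits-in-one-class ¬𝔪α ¬𝔪β with any? (λ c → 𝔪? (γ c))
      ... | no ∄ = zero , λ
        { zero 𝔪α → ⊥-elim (¬𝔪α 𝔪α)
        ; (suc zero) 𝔪β → ⊥-elim (¬𝔪β 𝔪β)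
        ; (suc (suc c)) 𝔪γ → ⊥-elim (∄ (c , 𝔪γ))
        }
      ... | yes (c₀ , 𝔪γc₀) = coordinateClass c₀ , λ
        { zero 𝔪α → ⊥-elim (¬𝔪α 𝔪α)
        ; (suc zero) 𝔪β → ⊥-elim (¬𝔪β 𝔪β)
        ; (suc (suc c)) 𝔪γ → pairing-unique (integral rμ zero) ¬𝔪α ¬𝔪β (𝔪γ⇒𝔪W c 𝔪γ) (𝔪γ⇒𝔪W c₀ 𝔪γc₀)
        }

    module _ {T l} (n≡T+l : n ≡ T ℕ.+ l) (room : suc (suc n) ℕ.≤ suc T ℕ.* d) where

      class-size : ∀ t → count (λ i → class i Fin.≟ t) ℕ.≤ suc T
      class-size t = begin
        count (λ i → class i Fin.≟ t)                                 ≤⟨ count-mono (λ i → class i Fin.≟ t) (P? ∘ toℕ) same-residue ⟩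
        count {m = suc (suc n)} (P? ∘ toℕ)                             ≤⟨ count-prefix P? room′ ⟩
        count {m = suc T ℕ.* d ℕ.+ toℕ t} (λ i → toℕ i % d ℕ.≟ toℕ t)  ≤⟨ count-mod d (toℕ t) (Fin.toℕ<n t) (suc T) ⟩
        suc T                                                          ∎
        where
        open ℕ.≤-Reasoning
        P? : ∀ v → Dec (v % d ≡ toℕ t)
        P? v = v % d ℕ.≟ toℕ t
        room′ : suc (suc n) ℕ.≤ suc T ℕ.* d ℕ.+ toℕ t
        room′ = ℕ.≤-trans room (ℕ.m≤m+n _ (toℕ t))
        same-residue : ∀ i → class i ≡ t → toℕ i % d ≡ toℕ t
        same-residue i class≡t = trans (sym (Fin.toℕ-fromℕ< _)) (cong toℕ class≡t)

      nonunits-spread : ∀ {μ t} → weight μ ℕ.≤ l → ¬ (∀ i → 𝔪 (μ i) → class i ≡ t)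
      nonunits-spread {μ} {t} weight≤l nonunits-in-t = ℕ.1+n≰n (begin
        suc (suc n)                          ≡⟨ count-∁ (λ i → 𝔪? (μ i)) ⟨
        count (λ i → 𝔪? (μ i)) ℕ.+ weight μ       ≤⟨ ℕ.+-mono-≤ nonunits≤ weight≤l ⟩
        suc T ℕ.+ l                            ≡⟨ cong ℕ.suc n≡T+l ⟨
        suc n                                  ∎)
        where
        open ℕ.≤-Reasoning
        nonunits≤ : count (λ i → 𝔪? (μ i)) ℕ.≤ suc T
        nonunits≤ = ℕ.≤-trans (count-mono (λ i → 𝔪? (μ i)) (λ i → class i Fin.≟ t) nonunits-in-t)
                              (class-size t)

      lineFamily-independent≤ : ResiduallyIndependent≤ l lineFamily
      lineFamily-independent≤ μ rμ weight≤l = by-cases (𝔪? (μ zero)) (𝔪? (μ (suc zero)))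
        where
        spread : ∀ {t} → ¬ (∀ i → 𝔪 (μ i) → class i ≡ t)
        spread = nonunits-spread weight≤l
        by-cases : Dec (𝔪 (μ zero)) → Dec (𝔪 (μ (suc zero))) → Trivial μ
        by-cases (yes 𝔪α) (yes 𝔪β) = trivial-if-𝔪 rμ 𝔪α 𝔪β
        by-cases (no ¬𝔪α) (yes 𝔪β) = ⊥-elim (spread (nonunits-where-U-vanishes rμ ¬𝔪α 𝔪β))
        by-cases (yes 𝔪α) (no ¬𝔪β) = ⊥-elim (spread (nonunits-where-V-vanishes rμ 𝔪α ¬𝔪β))
        by-cases (no ¬𝔪α) (no ¬𝔪β) = ⊥-elim (spread (proj₂ (nonunits-in-one-class rμ ¬𝔪α ¬𝔪β)))

  module Bounds (n l : ℕ) (2≤l : 2 ℕ.≤ l) (l≤n : l ℕ.≤ n) where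
    open Orthogonality K n
    open Dimension n

    ones-set : Σ (List Vecⁿ) λ S → KLOrthogonal l l S × length S ≡ suc n
    ones-set = tabulate onesAndBasis ,
               independent≤⇒KLOrthogonal onesAndBasis 2≤l onesAndBasis-integral (onesAndBasis-independent≤ l≤n) ,
               length-tabulate onesAndBasis

    upper-bound : q ℕ.* suc n ℕ.≤ l ℕ.* (q ℕ.+ 1) → ∀ S → KLOrthogonal l l S → length S ℕ.≤ suc n
    upper-bound q[n+1]≤l[q+1] S orthogonal with length S ℕ.≤? suc n
    ... | yes |S|≤n+1 = |S|≤n+1
    ... | no  |S|≰n+1 = ⊥-elim (pencil-count-absurd q n l q[n+1]≤l[q+1] (residual-bound w 𝒪w independent))
      where
      S′ = take (suc (suc n)) S
      orthogonal′ = KLOrthogonal-⊆ (take-Sublist (suc (suc n)) ⊆-refl) orthogonal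
      |S′|≡n+2 : length S′ ≡ suc (suc n)
      |S′|≡n+2 = trans (length-take _ S) (ℕ.m≤n⇒m⊓n≡m (ℕ.≰⇒> |S|≰n+1))
      l≤|S′| : l ℕ.≤ length S′
      l≤|S′| = subst (l ℕ.≤_) (sym |S′|≡n+2) (ℕ.≤-trans l≤n (ℕ.m≤n+m n 2))
      w : Fin (suc (suc n)) → Vecⁿ
      w = normalise ∘ lookup S′ ∘ cast (sym |S′|≡n+2)
      𝒪w : ∀ i → Integral (w i)
      𝒪w i = normalised⇒integral (KLOrthogonal⇒normalised S′ orthogonal′ (cast (sym |S′|≡n+2) i))
      independent : ResiduallyIndependent≤ l w
      independent = independent≤-cast (sym |S′|≡n+2) (KLOrthogonal⇒independent≤ S′ orthogonal′ l≤|S′|)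

    line-set : ¬ q ℕ.* suc n ℕ.≤ l ℕ.* (q ℕ.+ 1) →
               Σ (List Vecⁿ) λ S → KLOrthogonal l l S × length S ≡ suc (suc n)
    line-set = from-residues residue residue-int residue-inj z₀ 𝔪z₀
      where
      class-of-0 = residue-surj 0# (≤ν-0# _)
      z₀ = proj₁ class-of-0
      𝔪z₀ : 𝔪 (residue z₀)
      𝔪z₀ = ≤ν-resp-≈ (≈-trans (-‿cong (+-identityˡ _)) (-‿involutive _)) (≤ν-neg (proj₂ class-of-0))
      from-residues : ∀ {Q′} (res : Fin Q′ → Carrier) → (∀ r → 𝒪 (res r)) →
                      (∀ r s → 𝔪 (res r - res s) → r ≡ s) → ∀ z → 𝔪 (res z) →
                      ¬ Q′ ℕ.* suc n ℕ.≤ l ℕ.* (Q′ ℕ.+ 1) →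
                      Σ (List Vecⁿ) λ S → KLOrthogonal l l S × length S ≡ suc (suc n)
      from-residues {suc Q} res 𝒪res incongruent z 𝔪z too-few =
        tabulate lineFamily ,
        independent≤⇒KLOrthogonal lineFamily 2≤l lineFamily-integral (lineFamily-independent≤ n≡T+l room) ,
        length-tabulate lineFamily
        where
        ρ : Fin (suc Q) → Carrier
        ρ zero    = res z
        ρ (suc s) = res (punchIn z s)
        𝒪ρ : ∀ r → 𝒪 (ρ r)
        𝒪ρ zero    = 𝒪res z
        𝒪ρ (suc s) = 𝒪res (punchIn z s)
        ρ-incongruent : ∀ r s → 𝔪 (ρ r - ρ s) → r ≡ s
        ρ-incongruent zero    zero    _ = refl
        ρ-incongruent zero    (suc s) h = ⊥-elim (punchInᵢ≢i z s (sym (incongruent z (punchIn z s) h)))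
        ρ-incongruent (suc r) zero    h = ⊥-elim (punchInᵢ≢i z r (incongruent (punchIn z r) z h))
        ρ-incongruent (suc r) (suc s) h = cong suc (Fin.punchIn-injective z r s (incongruent _ _ h))
        open LineFamily ρ 𝒪ρ ρ-incongruent 𝔪z {n}
        T = n ℕ.∸ l
        n≡T+l : n ≡ T ℕ.+ l
        n≡T+l = sym (ℕ.m∸n+n≡m l≤n)
        room : suc (suc n) ℕ.≤ suc T ℕ.* d
        room = room-for-classes (suc Q) n T l n≡T+l too-few

open import Data.Nat using (suc; _+_; _*_; _≤_)

lemma3p23 : ∀ {c ℓ' : Level} (K : DVField c ℓ') (n l : ℕ) → 2 ≤ l → l ≤ n →
    Orthogonality.ΘIs K n l l (suc n) ⇔ (DVField.q K * suc n ≤ l * (DVField.q K + 1))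
lemma3p23 K n l 2≤l l≤n = mk⇔
  (λ { (lift (_ , maximal)) → decidable-stable (_ ℕ.≤? _) λ too-few →
         let S , orthogonal , |S|≡n+2 = line-set too-few in
         ℕ.1+n≰n (subst (_≤ suc n) |S|≡n+2 (maximal S orthogonal)) })
  (λ q[n+1]≤l[q+1] → lift (ones-set , upper-bound q[n+1]≤l[q+1]))
  where open Bounds K n l 2≤l l≤n
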